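{- Let $t\ge1$. For $n\ge1$, the Möbius number of $B_n^{(t)}$ is $(-1)^n w_n^{(t)}$, where $w_n^{(t)}$ is the number of $t$-tuples of permutations in $\mathfrak{S}_n$ with no common ascent. Setting $w_0^{(t)}=1$, the numbers $w_n^{(t)}$ satisfy, for all $n\ge1$, \[\sum_{i=0}^n(-1)^i w_i^{(t)}\binom{n}{i}^t=0,\] and, as formal power series, \[\sum_{n\ge0} w_n^{(t)}\frac{z^n}{n!^t}=\frac{1}{f(z)},\qquad f(z)=\sum_{n\ge0}(-1)^n\frac{z^n}{n!^t}.\] More generally, for $J\subseteq[n-1]$ the Möbius number $\mu(B_n^{(t)}(J))$ of the rank-selected subposet equals $(-1)^{|J|-1}w_n^{(t)}(J)$, where $w_n^{(t)}(J)$ is the number of $t$-tuples of permutations in $\mathfrak{S}_n$ whose set of common ascents equals $[n-1]\setminus J$.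
   Context: $B_n$ is the Boolean lattice of subsets of $[n]=\{1,\ldots,n\}$ ordered by inclusion. For $t\ge2$, the $t$-fold Segre power $B_n^{(t)}$ is the subposet of $B_n\times\cdots\times B_n$ ($t$ factors, componentwise order) consisting of $t$-tuples $(A_1,\ldots,A_t)$ with $|A_1|=\cdots=|A_t|$; $B_n^{(1)}=B_n$. An ascent of $\sigma\in\mathfrak{S}_n$ is an $i\in[n-1]$ with $\sigma(i)<\sigma(i+1)$. For $J\subseteq[n-1]$, $B_n^{(t)}(J)$ is the subposet of elements whose rank (common cardinality) lies in $J$, together with the bottom and top elements. The Möbius number of a bounded poset is $\mu(\hat0,\hat1)$. -}

module Defs where

open import Data.Bool.Base using (Bool; true; false; _∧_; _∨_; not; if_then_else_; T)
open import Data.Nat.Base using (ℕ; zero; suc; _+_; _*_; _∸_; _^_; _≡ᵇ_; _<ᵇ_; _!)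
open import Data.Nat.Properties using (_!≢0; m^n≢0)
open import Data.Nat.Combinatorics using (_C_)
open import Data.Fin.Base using (Fin; toℕ; inject₁) renaming (suc to fsuc; zero to fzero)
open import Data.Fin.Subset using (Subset; ∣_∣; _∈_; _∉_)
open import Data.Vec.Base using (Vec; []; _∷_; lookup; zipWith; allFin)
open import Data.List.Base using (List; []; _∷_; map; concatMap; filterᵇ; length; upTo; foldr)
import Data.Vec.Base as V
open import Data.Integer.Base as ℤ using (ℤ; +_)
open import Data.Rational.Base as ℚ using (ℚ)

allVecs : {A : Set} → List A → (n : ℕ) → List (Vec A n)
allVecs xs zero    = [] ∷ []
allVecs xs (suc n) = concatMap (λ x → map (x ∷_) (allVecs xs n)) xs

allBoolean : Bool → Bool → Bool
allBoolean true  true  = true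
allBoolean false false = true
allBoolean _     _     = false

allᵥ : {A : Set} {n : ℕ} → (A → Bool) → Vec A n → Bool
allᵥ p []       = true
allᵥ p (x ∷ xs) = p x ∧ allᵥ p xs

anyᵥ : {A : Set} {n : ℕ} → (A → Bool) → Vec A n → Bool
anyᵥ p []       = false
anyᵥ p (x ∷ xs) = p x ∨ anyᵥ p xs

sumℤ : List ℤ → ℤ
sumℤ = foldr ℤ._+_ (+ 0)

sumℤTo : ℕ → (ℕ → ℤ) → ℤ
sumℤTo n f = sumℤ (map f (upTo (suc n)))

sumℚTo : ℕ → (ℕ → ℚ) → ℚ
sumℚTo n f = foldr ℚ._+_ ℚ.0ℚ (map f (upTo (suc n)))

sgn : ℕ → ℤ
sgn k = ℤ.-1ℤ ℤ.^ k

-- The poset is given by a finite list of its elements `els`, a boolean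
-- order relation `leq` and a boolean equality `eq`.  `mobiusAux k x y`
-- computes μ(x,y) with recursion fuel k; the fuel `length els` is always
-- sufficient (a strict chain x = z₀ < … < y has at most `length els`
-- elements), so `mobius` below is the Möbius function.

module Möbius {A : Set} (els : List A) (leq : A → A → Bool) (eq : A → A → Bool) where

  mobiusAux : ℕ → A → A → ℤ
  mobiusAux zero    x y = + 0
  mobiusAux (suc k) x y =
    if eq x y then + 1
    else (if leq x y
          then ℤ.- sumℤ (map (mobiusAux k x)
                  (filterᵇ (λ z → leq x z ∧ leq z y ∧ not (eq z y)) els))
          else + 0)

  mobius : A → A → ℤ
  mobius = mobiusAux (length els)

allSubsets : (n : ℕ) → List (Subset n)
allSubsets n = allVecs (true ∷ false ∷ []) n

⊆ᵇ : {n : ℕ} → Subset n → Subset n → Bool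
⊆ᵇ []       []       = true
⊆ᵇ (a ∷ as) (b ∷ bs) = (not a ∨ b) ∧ ⊆ᵇ as bs

≡ᵇ-sub : {n : ℕ} → Subset n → Subset n → Bool
≡ᵇ-sub []       []       = true
≡ᵇ-sub (a ∷ as) (b ∷ bs) = allBoolean a b ∧ ≡ᵇ-sub as bs

Tuple : ℕ → ℕ → Set
Tuple t n = Vec (Subset n) t

leqTuple : {t n : ℕ} → Tuple t n → Tuple t n → Bool
leqTuple xs ys = allᵥ (λ b → b) (zipWith ⊆ᵇ xs ys)

eqTuple : {t n : ℕ} → Tuple t n → Tuple t n → Bool
eqTuple xs ys = allᵥ (λ b → b) (zipWith ≡ᵇ-sub xs ys)

tuplesOfRank : (t n r : ℕ) → List (Tuple t n)
tuplesOfRank t n r = filterᵇ (allᵥ (λ A → ∣ A ∣ ≡ᵇ r)) (allVecs (allSubsets n) t)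

-- Elements of B_n^{(t)} whose (common) rank r satisfies `sel r`
-- (for t ≥ 1 every element occurs exactly once).
segreElems : (t n : ℕ) → (ℕ → Bool) → List (Tuple t n)
segreElems t n sel = concatMap (λ r → if sel r then tuplesOfRank t n r else []) (upTo (suc n))

bottomT : (t n : ℕ) → Tuple t n
bottomT t n = V.replicate t (V.replicate n false)

topT : (t n : ℕ) → Tuple t n
topT t n = V.replicate t (V.replicate n true)

mobiusSegre : (t n : ℕ) → ℤ
mobiusSegre t n = Möbius.mobius (segreElems t n (λ _ → true)) leqTuple eqTuple (bottomT t n) (topT t n)

-- Rank selection.  For n = suc m, a subset J ⊆ [n-1] = {1,…,m} is
-- represented as J : Subset m, where i : Fin m stands for the rank toℕ i + 1.
inJ : {m : ℕ} → Subset m → ℕ → Bool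
inJ {m} J r = anyᵥ (λ i → (toℕ i + 1 ≡ᵇ r) ∧ lookup J i) (allFin m)

mobiusSegreRankSel : (t m : ℕ) → Subset m → ℤ
mobiusSegreRankSel t m J =
  Möbius.mobius (segreElems t (suc m) (λ r → (r ≡ᵇ 0) ∨ (r ≡ᵇ suc m) ∨ inJ J r))
                leqTuple eqTuple (bottomT t (suc m)) (topT t (suc m))

Word : ℕ → Set
Word n = Vec (Fin n) n

eqFin : {n : ℕ} → Fin n → Fin n → Bool
eqFin i j = toℕ i ≡ᵇ toℕ j

isPerm : {n : ℕ} → Word n → Bool
isPerm {n} σ = allᵥ (λ i → allᵥ (λ j → eqFin i j ∨ not (eqFin (lookup σ i) (lookup σ j))) (allFin n)) (allFin n)

-- i : Fin m (standing for position i+1 ∈ [n-1], n = suc m) is an ascent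
-- of σ iff σ(i+1) < σ(i+2).
isAscent : {m : ℕ} → Word (suc m) → Fin m → Bool
isAscent σ i = toℕ (lookup σ (inject₁ i)) <ᵇ toℕ (lookup σ (fsuc i))

isCommonAscent : {t m : ℕ} → Vec (Word (suc m)) t → Fin m → Bool
isCommonAscent τ i = allᵥ (λ σ → isAscent σ i) τ

permTuples : (t n : ℕ) → List (Vec (Word n) t)
permTuples t n = allVecs (filterᵇ isPerm (allVecs (V.toList (allFin n)) n)) t

wJ : (t m : ℕ) → Subset m → ℕ
wJ t m J = length (filterᵇ
  (λ τ → allᵥ (λ i → allBoolean (isCommonAscent τ i) (not (lookup J i))) (allFin m))
  (permTuples t (suc m)))

w : (t n : ℕ) → ℕ
w t zero    = 1
w t (suc m) = length (filterᵇ
  (λ τ → allᵥ (λ i → not (isCommonAscent τ i)) (allFin m))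
  (permTuples t (suc m)))

PowerSeries : Set
PowerSeries = ℕ → ℚ

_·ₚ_ : PowerSeries → PowerSeries → PowerSeries
(a ·ₚ b) n = sumℚTo n (λ i → a i ℚ.* b (n ∸ i))

oneₚ : PowerSeries
oneₚ zero    = ℚ.1ℚ
oneₚ (suc _) = ℚ.0ℚ

Wseries : ℕ → PowerSeries
Wseries t n = (+ w t n ℚ./ ((n !) ^ t)) {{m^n≢0 (n !) t {{n !≢0}}}}

fseries : ℕ → PowerSeries
fseries t n = (sgn n ℚ./ ((n !) ^ t)) {{m^n≢0 (n !) t {{n !≢0}}}}

{-# OPTIONS --safe #-}
module Submission where

-- An element of rank r of the Segre power B_n^(t) lies above exactly binom(r,s)^t elements of
-- rank s, so μ(0̂, x) depends only on the rank r of x and, in the rank selection, satisfies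
-- μ_r = - Σ_{s < r selected} binom(r,s)^t μ_s.  This recursion is solved by Philip Hall's sum
-- μ_n = Σ_{S ⊆ J} (-1)^{|S|+1} α(S)^t, where α(S), the number of permutations with descent set
-- in S, counts the maximal chains of B_n(S).  On the other hand α(S)^t counts the t-tuples of
-- permutations whose common ascent set contains [n-1] ∖ S, so inclusion–exclusion gives
-- w_n(J) = Σ_{S ⊆ J} (-1)^{|J ∖ S|} α(S)^t.  The recurrence for w_n is the Möbius recursion of
-- the full Segre power, and dividing it by n!^t gives W(z) f(z) = 1 coefficientwise.

module RankSelectedSegrePowers where

  open import Data.Bool.Base using (Bool; true; false; _∧_; _∨_; not; if_then_else_; T)
  open import Data.Bool.Properties using (T?; ∧-commutativeMonoid; ∧-assoc; ∧-idem; ∧-zeroʳ; ∧-identityʳ; ∨-zeroʳ; ∨-identityʳ; ∨-distribˡ-∧)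
  open import Data.Nat.Base using (ℕ; zero; suc; pred; _+_; _*_; _∸_; _^_; _!; _≤_; _<_; _≡ᵇ_; _<ᵇ_; z≤n; s≤s; NonZero)
  open import Data.Nat.Properties
  open import Data.Nat.Combinatorics using (_C_; nCk+nC[k+1]≡[n+1]C[k+1])
  open import Data.Nat.Tactic.RingSolver using (solve-∀)
  open import Data.Fin.Base using (Fin; toℕ; inject₁) renaming (suc to fsuc; zero to fzero)
  open import Data.Fin.Properties using (toℕ<n)
  open import Data.Fin.Subset using (Subset; ∣_∣)
  open import Data.Fin.Subset.Properties using (∣⊤∣≡n)
  open import Data.Vec.Base as Vec using (Vec; []; _∷_; lookup; allFin)
  import Data.Vec.Properties as Vec
  open import Data.List.Base as List
    using (List; []; _∷_; map; concatMap; filterᵇ; length; _++_; upTo; applyUpTo; replicate; tabulate)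
  open import Data.List.Properties
    using (map-++; length-++; filter-++; ++-assoc; ++-identityʳ; applyUpTo-∷ʳ; length-replicate; tabulate-cong; length-tabulate)
  open import Data.Nat.ListAction using (sum)
  open import Data.List.Membership.Propositional using (_∈_)
  open import Data.List.Membership.Propositional.Properties using (∈-filter⁻; ∈-upTo⁻)
  open import Data.List.Relation.Unary.Any using (here; there)
  open import Data.List.Relation.Unary.All as All using (All; []; _∷_)
  open import Data.List.Relation.Unary.AllPairs using (AllPairs; []; _∷_)
  open import Data.Integer.Base as ℤ using (ℤ; +_) renaming (_+_ to _+ℤ_; _*_ to _*ℤ_; -_ to -ℤ_; _-_ to _-ℤ_)
  import Data.Integer.Properties as ℤ
  import Data.Integer.Tactic.RingSolver as ℤ-Solver
  open import Data.Rational.Base as ℚ using (ℚ; toℚᵘ)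
  import Data.Rational.Properties as ℚ
  open import Data.Rational.Unnormalised.Base as ℚᵘ using (ℚᵘ; mkℚᵘ; *≡*; _≃_)
  import Data.Rational.Unnormalised.Properties as ℚᵘ
  open import Data.Product.Base using (_×_; _,_; proj₁; proj₂)
  open import Data.Unit.Base using (tt)
  open import Data.Empty using (⊥-elim)
  open import Data.Vec.Functional using () renaming (_∷_ to _∷ᶠ_)
  open import Function.Base using (_∘_)
  open import Algebra.Bundles using (CommutativeMonoid)
  open import Algebra.Properties.CommutativeSemigroup (CommutativeMonoid.commutativeSemigroup ∧-commutativeMonoid)
    using () renaming (interchange to ∧-interchange)
  open import Relation.Nullary using (¬_; yes; no)
  open import Relation.Binary.PropositionalEquality
  open import Defs

  private variable
    A B : Set

  countᵇ : (A → Bool) → List A → ℕ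
  countᵇ p xs = length (filterᵇ p xs)

  countᵇ-++ : (p : A → Bool) (xs ys : List A) → countᵇ p (xs ++ ys) ≡ countᵇ p xs + countᵇ p ys
  countᵇ-++ p xs ys = trans (cong length (filter-++ (T? ∘ p) xs ys)) (length-++ (filterᵇ p xs))

  countᵇ-concatMap : (p : B → Bool) (f : A → List B) (xs : List A) →
    countᵇ p (concatMap f xs) ≡ sum (map (λ x → countᵇ p (f x)) xs)
  countᵇ-concatMap p f [] = refl
  countᵇ-concatMap p f (x ∷ xs) =
    trans (countᵇ-++ p (f x) (concatMap f xs)) (cong (_+_ (countᵇ p (f x))) (countᵇ-concatMap p f xs))

  countᵇ-map : (p : B → Bool) (f : A → B) (xs : List A) → countᵇ p (map f xs) ≡ countᵇ (p ∘ f) xs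
  countᵇ-map p f [] = refl
  countᵇ-map p f (x ∷ xs) with p (f x)
  ... | true  = cong suc (countᵇ-map p f xs)
  ... | false = countᵇ-map p f xs

  countᵇ-cong : (p q : A → Bool) (xs : List A) → (∀ {x} → x ∈ xs → p x ≡ q x) → countᵇ p xs ≡ countᵇ q xs
  countᵇ-cong p q [] h = refl
  countᵇ-cong p q (x ∷ xs) h with p x | q x | h (here refl)
  ... | true  | true  | _ = cong suc (countᵇ-cong p q xs (h ∘ there))
  ... | false | false | _ = countᵇ-cong p q xs (h ∘ there)

  countᵇ-∷ : (p : A → Bool) (x : A) (xs : List A) →
    countᵇ p (x ∷ xs) ≡ (if p x then suc (countᵇ p xs) else countᵇ p xs)
  countᵇ-∷ p x xs with p x
  ... | true  = refl
  ... | false = refl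

  countᵇ-true : (xs : List A) → countᵇ (λ _ → true) xs ≡ length xs
  countᵇ-true [] = refl
  countᵇ-true (x ∷ xs) = cong suc (countᵇ-true xs)

  countᵇ-false : (xs : List A) → countᵇ (λ _ → false) xs ≡ 0
  countᵇ-false [] = refl
  countᵇ-false (x ∷ xs) = countᵇ-false xs

  countᵇ-∧ˡ : (b : Bool) (q : A → Bool) (xs : List A) → countᵇ (λ x → b ∧ q x) xs ≡ (if b then countᵇ q xs else 0)
  countᵇ-∧ˡ true  q xs = refl
  countᵇ-∧ˡ false q xs = countᵇ-false xs

  countᵇ-split : (b q : A → Bool) (xs : List A) →
    countᵇ q xs ≡ countᵇ (λ x → b x ∧ q x) xs + countᵇ (λ x → not (b x) ∧ q x) xs
  countᵇ-split b q [] = refl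
  countᵇ-split b q (x ∷ xs) with b x | q x
  ... | true  | true  = cong suc (countᵇ-split b q xs)
  ... | false | true  = trans (cong suc (countᵇ-split b q xs)) (sym (+-suc _ _))
  ... | true  | false = countᵇ-split b q xs
  ... | false | false = countᵇ-split b q xs

  +countᵇ-not : (b q : A → Bool) (xs : List A) →
    + countᵇ (λ x → not (b x) ∧ q x) xs ≡ + countᵇ q xs -ℤ + countᵇ (λ x → b x ∧ q x) xs
  +countᵇ-not b q xs = begin
    + countᵇ (λ x → not (b x) ∧ q x) xs                       ≡⟨ complement (+ countᵇ (λ x → b x ∧ q x) xs) _ ⟩
    (+ countᵇ (λ x → b x ∧ q x) xs +ℤ + countᵇ (λ x → not (b x) ∧ q x) xs) -ℤ + countᵇ (λ x → b x ∧ q x) xs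
      ≡⟨ cong (_-ℤ + countᵇ (λ x → b x ∧ q x) xs) (ℤ.pos-+ (countᵇ (λ x → b x ∧ q x) xs) (countᵇ (λ x → not (b x) ∧ q x) xs)) ⟨
    + (countᵇ (λ x → b x ∧ q x) xs + countᵇ (λ x → not (b x) ∧ q x) xs) -ℤ + countᵇ (λ x → b x ∧ q x) xs
      ≡⟨ cong (λ n → + n -ℤ + countᵇ (λ x → b x ∧ q x) xs) (countᵇ-split b q xs) ⟨
    + countᵇ q xs -ℤ + countᵇ (λ x → b x ∧ q x) xs            ∎
    where
    open ≡-Reasoning
    complement : ∀ (a b : ℤ) → b ≡ (a +ℤ b) -ℤ a
    complement = ℤ-Solver.solve-∀

  filterᵇ-filterᵇ : (p q : A → Bool) (xs : List A) → filterᵇ p (filterᵇ q xs) ≡ filterᵇ (λ x → q x ∧ p x) xs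
  filterᵇ-filterᵇ p q [] = refl
  filterᵇ-filterᵇ p q (x ∷ xs) with q x
  ... | false = filterᵇ-filterᵇ p q xs
  ... | true with p x
  ...   | true  = cong (x ∷_) (filterᵇ-filterᵇ p q xs)
  ...   | false = filterᵇ-filterᵇ p q xs

  filterᵇ-none : (p : A → Bool) (xs : List A) → (∀ {x} → x ∈ xs → p x ≡ false) → filterᵇ p xs ≡ []
  filterᵇ-none p [] h = refl
  filterᵇ-none p (x ∷ xs) h with p x | h (here refl)
  ... | false | _ = filterᵇ-none p xs (h ∘ there)

  T⇒≡true : ∀ {b} → T b → b ≡ true
  T⇒≡true {true} _ = refl

  ∈-filterᵇ⁻ : (p : A → Bool) {xs : List A} {x : A} → x ∈ filterᵇ p xs → x ∈ xs × p x ≡ true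
  ∈-filterᵇ⁻ p m with x∈xs , px ← ∈-filter⁻ (T? ∘ p) m = x∈xs , T⇒≡true px

  filterᵇ-concatMap : (p : B → Bool) (f : A → List B) (xs : List A) →
    filterᵇ p (concatMap f xs) ≡ concatMap (filterᵇ p ∘ f) xs
  filterᵇ-concatMap p f [] = refl
  filterᵇ-concatMap p f (x ∷ xs) =
    trans (filter-++ (T? ∘ p) (f x) (concatMap f xs)) (cong (filterᵇ p (f x) ++_) (filterᵇ-concatMap p f xs))

  sum-map-cong : (f g : A → ℕ) (xs : List A) → (∀ {x} → x ∈ xs → f x ≡ g x) → sum (map f xs) ≡ sum (map g xs)
  sum-map-cong f g [] h = refl
  sum-map-cong f g (x ∷ xs) h = cong₂ _+_ (h (here refl)) (sum-map-cong f g xs (h ∘ there))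

  sum-map-if : (q : A → Bool) (c : ℕ) (xs : List A) → sum (map (λ x → if q x then c else 0) xs) ≡ countᵇ q xs * c
  sum-map-if q c [] = refl
  sum-map-if q c (x ∷ xs) with q x
  ... | true  = cong (_+_ c) (sum-map-if q c xs)
  ... | false = sum-map-if q c xs

  sumℤ-++ : (xs ys : List ℤ) → sumℤ (xs ++ ys) ≡ sumℤ xs +ℤ sumℤ ys
  sumℤ-++ [] ys = sym (ℤ.+-identityˡ _)
  sumℤ-++ (x ∷ xs) ys = trans (cong (x +ℤ_) (sumℤ-++ xs ys)) (sym (ℤ.+-assoc x _ _))

  sumℤ-map-cong : (f g : A → ℤ) (xs : List A) → (∀ {x} → x ∈ xs → f x ≡ g x) → sumℤ (map f xs) ≡ sumℤ (map g xs)
  sumℤ-map-cong f g [] h = refl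
  sumℤ-map-cong f g (x ∷ xs) h = cong₂ _+ℤ_ (h (here refl)) (sumℤ-map-cong f g xs (h ∘ there))

  sumℤ-map-const : (f : A → ℤ) (c : ℤ) (xs : List A) → (∀ {x} → x ∈ xs → f x ≡ c) →
    sumℤ (map f xs) ≡ + length xs *ℤ c
  sumℤ-map-const f c [] h = sym (ℤ.*-zeroˡ c)
  sumℤ-map-const f c (x ∷ xs) h = begin
    f x +ℤ sumℤ (map f xs)          ≡⟨ cong₂ _+ℤ_ (h (here refl)) (sumℤ-map-const f c xs (h ∘ there)) ⟩
    c +ℤ + length xs *ℤ c           ≡⟨ cong (_+ℤ (+ length xs *ℤ c)) (sym (ℤ.*-identityˡ c)) ⟩
    + 1 *ℤ c +ℤ + length xs *ℤ c    ≡⟨ sym (ℤ.*-distribʳ-+ c (+ 1) (+ length xs)) ⟩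
    + suc (length xs) *ℤ c          ∎
    where open ≡-Reasoning

  sumℤ-map-*ˡ : (k : ℤ) (f : A → ℤ) (xs : List A) → sumℤ (map (λ x → k *ℤ f x) xs) ≡ k *ℤ sumℤ (map f xs)
  sumℤ-map-*ˡ k f [] = sym (ℤ.*-zeroʳ k)
  sumℤ-map-*ˡ k f (x ∷ xs) = trans (cong (k *ℤ f x +ℤ_) (sumℤ-map-*ˡ k f xs)) (sym (ℤ.*-distribˡ-+ k (f x) _))

  sumℤ-map-concatMap : (g : B → ℤ) (f : A → List B) (xs : List A) →
    sumℤ (map g (concatMap f xs)) ≡ sumℤ (map (λ x → sumℤ (map g (f x))) xs)
  sumℤ-map-concatMap g f [] = refl
  sumℤ-map-concatMap g f (x ∷ xs) = begin
    sumℤ (map g (f x ++ concatMap f xs))                   ≡⟨ cong sumℤ (map-++ g (f x) (concatMap f xs)) ⟩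
    sumℤ (map g (f x) ++ map g (concatMap f xs))           ≡⟨ sumℤ-++ (map g (f x)) _ ⟩
    sumℤ (map g (f x)) +ℤ sumℤ (map g (concatMap f xs))    ≡⟨ cong (sumℤ (map g (f x)) +ℤ_) (sumℤ-map-concatMap g f xs) ⟩
    sumℤ (map g (f x)) +ℤ sumℤ (map (λ y → sumℤ (map g (f y))) xs) ∎
    where open ≡-Reasoning

  sumBelowℤ : ℕ → (ℕ → ℤ) → ℤ
  sumBelowℤ r f = sumℤ (map f (upTo r))

  sumBelowℤ-suc : ∀ r f → sumBelowℤ (suc r) f ≡ sumBelowℤ r f +ℤ f r
  sumBelowℤ-suc r f = begin
    sumℤ (map f (upTo (suc r)))              ≡⟨ cong (sumℤ ∘ map f) (sym (applyUpTo-∷ʳ (λ x → x) r)) ⟩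
    sumℤ (map f (upTo r ++ r ∷ []))          ≡⟨ cong sumℤ (map-++ f (upTo r) (r ∷ [])) ⟩
    sumℤ (map f (upTo r) ++ f r ∷ [])        ≡⟨ sumℤ-++ (map f (upTo r)) (f r ∷ []) ⟩
    sumBelowℤ r f +ℤ (f r +ℤ + 0)            ≡⟨ cong (sumBelowℤ r f +ℤ_) (ℤ.+-identityʳ (f r)) ⟩
    sumBelowℤ r f +ℤ f r                     ∎
    where open ≡-Reasoning

  ≡ᵇ⇒≡′ : ∀ {m n} → (m ≡ᵇ n) ≡ true → m ≡ n
  ≡ᵇ⇒≡′ {m} {n} e = ≡ᵇ⇒≡ m n (subst T (sym e) tt)

  ≡ᵇ-refl : ∀ n → (n ≡ᵇ n) ≡ true
  ≡ᵇ-refl zero    = refl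
  ≡ᵇ-refl (suc n) = ≡ᵇ-refl n

  ≡ᵇ-sym : ∀ m n → (m ≡ᵇ n) ≡ (n ≡ᵇ m)
  ≡ᵇ-sym zero    zero    = refl
  ≡ᵇ-sym zero    (suc n) = refl
  ≡ᵇ-sym (suc m) zero    = refl
  ≡ᵇ-sym (suc m) (suc n) = ≡ᵇ-sym m n

  ≢⇒≡ᵇ≡false : ∀ {m n} → m ≢ n → (m ≡ᵇ n) ≡ false
  ≢⇒≡ᵇ≡false {m} {n} m≢n with m ≡ᵇ n in e
  ... | false = refl
  ... | true  = ⊥-elim (m≢n (≡ᵇ⇒≡′ e))

  <⇒<ᵇ≡true : ∀ {m n} → m < n → (m <ᵇ n) ≡ true
  <⇒<ᵇ≡true m<n = T⇒≡true (<⇒<ᵇ m<n)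

  ≮⇒<ᵇ≡false : ∀ {m n} → ¬ m < n → (m <ᵇ n) ≡ false
  ≮⇒<ᵇ≡false {m} {n} m≮n with m <ᵇ n in e
  ... | false = refl
  ... | true  = ⊥-elim (m≮n (<ᵇ⇒< m n (subst T (sym e) tt)))

  <ᵇ-irrefl : ∀ n → (n <ᵇ n) ≡ false
  <ᵇ-irrefl n = ≮⇒<ᵇ≡false (n≮n n)

  <ᵇ-trans : ∀ a b c → (a <ᵇ b) ≡ true → (b <ᵇ c) ≡ true → (a <ᵇ c) ≡ true
  <ᵇ-trans zero    (suc b) (suc c) _ _ = refl
  <ᵇ-trans (suc a) (suc b) (suc c) p q = <ᵇ-trans a b c p q

  <ᵇ-asym : ∀ a b → (a <ᵇ b) ≡ true → (b <ᵇ a) ≡ false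
  <ᵇ-asym zero    (suc b) _ = refl
  <ᵇ-asym (suc a) (suc b) p = <ᵇ-asym a b p

  <ᵇ⇒≡ᵇ≡false : ∀ a b → (a <ᵇ b) ≡ true → (b ≡ᵇ a) ≡ false
  <ᵇ⇒≡ᵇ≡false zero    (suc b) _ = refl
  <ᵇ⇒≡ᵇ≡false (suc a) (suc b) p = <ᵇ⇒≡ᵇ≡false a b p

  ∧-true⁻ˡ : ∀ a b → (a ∧ b) ≡ true → a ≡ true
  ∧-true⁻ˡ true b _ = refl

  ∧-true⁻ʳ : ∀ a b → (a ∧ b) ≡ true → b ≡ true
  ∧-true⁻ʳ true b e = e

  allBoolean-true : ∀ b → allBoolean b true ≡ b
  allBoolean-true true  = refl
  allBoolean-true false = refl

  allBoolean-false : ∀ b → allBoolean b false ≡ not b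
  allBoolean-false true  = refl
  allBoolean-false false = refl

  -- Binomial coefficients

  -- binom is _C_ (see C≡binom) defined by Pascal's rule, so that it unfolds by computation.
  binom : ℕ → ℕ → ℕ
  binom n       zero    = 1
  binom zero    (suc k) = 0
  binom (suc n) (suc k) = binom n k + binom n (suc k)

  C≡binom : ∀ n k → n C k ≡ binom n k
  C≡binom n       zero    = refl
  C≡binom zero    (suc k) = refl
  C≡binom (suc n) (suc k) =
    trans (sym (nCk+nC[k+1]≡[n+1]C[k+1] n k)) (cong₂ _+_ (C≡binom n k) (C≡binom n (suc k)))

  binom-≡0 : ∀ {n k} → n < k → binom n k ≡ 0
  binom-≡0 {zero}  {suc k} _          = refl
  binom-≡0 {suc n} {suc k} (s≤s n<k) = cong₂ _+_ (binom-≡0 n<k) (binom-≡0 (m≤n⇒m≤1+n n<k))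

  binom-diag : ∀ n → binom n n ≡ 1
  binom-diag zero    = refl
  binom-diag (suc n) = cong₂ _+_ (binom-diag n) (binom-≡0 (n<1+n n))

  binom-pos : ∀ {n k} → k ≤ n → 1 ≤ binom n k
  binom-pos {n}     {zero}  _         = ≤-refl
  binom-pos {suc n} {suc k} (s≤s k≤n) = ≤-trans (binom-pos k≤n) (m≤m+n _ _)

  sumBelow : ℕ → (ℕ → ℕ) → ℕ
  sumBelow zero    f = 0
  sumBelow (suc u) f = sumBelow u f + f u

  sumBelow-cong : ∀ u {f g : ℕ → ℕ} → (∀ v → f v ≡ g v) → sumBelow u f ≡ sumBelow u g
  sumBelow-cong zero    h = refl
  sumBelow-cong (suc u) h = cong₂ _+_ (sumBelow-cong u h) (h u)

  sumBelow-*ʳ : ∀ u (f : ℕ → ℕ) c → sumBelow u (λ v → f v * c) ≡ sumBelow u f * c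
  sumBelow-*ʳ zero    f c = refl
  sumBelow-*ʳ (suc u) f c =
    trans (cong (_+ f u * c) (sumBelow-*ʳ u f c)) (sym (*-distribʳ-+ c (sumBelow u f) (f u)))

  hockey-stick : ∀ u j → sumBelow u (λ v → binom v j) ≡ binom u (suc j)
  hockey-stick zero    j = refl
  hockey-stick (suc u) j = trans (cong (_+ binom u j) (hockey-stick u j)) (+-comm (binom u (suc j)) (binom u j))

  ^-distribʳ-* : ∀ a b n → (a * b) ^ n ≡ a ^ n * b ^ n
  ^-distribʳ-* a b zero    = refl
  ^-distribʳ-* a b (suc n) = trans (cong ((a * b) *_) (^-distribʳ-* a b n)) (swap a b (a ^ n) (b ^ n))
    where
    swap : ∀ a b x y → (a * b) * (x * y) ≡ (a * x) * (b * y)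
    swap = solve-∀

  binom-factorials : ∀ k l → binom (k + l) k * (k ! * l !) ≡ (k + l) !
  binom-factorials zero    l       = trans (*-identityˡ _) (*-identityˡ _)
  binom-factorials (suc k) zero    = begin
    binom (suc k + 0) (suc k) * (suc k ! * 1) ≡⟨ cong₂ _*_ (trans (cong (λ z → binom z (suc k)) (+-identityʳ (suc k)))
                                                                   (binom-diag (suc k))) (*-identityʳ _) ⟩
    1 * suc k !                               ≡⟨ *-identityˡ _ ⟩
    suc k !                                   ≡⟨ cong _! (sym (+-identityʳ (suc k))) ⟩
    (suc k + 0) !                             ∎
    where open ≡-Reasoning
  binom-factorials (suc k) (suc l) = begin
    (binom (k + suc l) k + binom (k + suc l) (suc k)) * ((suc k * k !) * (suc l * l !))
      ≡⟨ cong (λ y → (binom (k + suc l) k + y) * ((suc k * k !) * (suc l * l !)))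
              (cong (λ z → binom z (suc k)) (+-suc k l)) ⟩
    (X + Y) * ((suc k * k !) * (suc l * l !))
      ≡⟨ distribute k l X Y (k !) (l !) ⟩
    suc k * (X * (k ! * (suc l * l !))) + suc l * (Y * ((suc k * k !) * l !))
      ≡⟨ cong₂ (λ a b → suc k * a + suc l * b) (binom-factorials k (suc l))
               (trans (binom-factorials (suc k) l) (cong _! (sym (+-suc k l)))) ⟩
    suc k * (k + suc l) ! + suc l * (k + suc l) !
      ≡⟨ collect k l ((k + suc l) !) ⟩
    suc (k + suc l) * (k + suc l) ! ∎
    where
    open ≡-Reasoning
    X = binom (k + suc l) k
    Y = binom (suc k + l) (suc k)
    distribute : ∀ k l X Y kf lf → (X + Y) * ((suc k * kf) * (suc l * lf))
               ≡ suc k * (X * (kf * (suc l * lf))) + suc l * (Y * ((suc k * kf) * lf))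
    distribute = solve-∀
    collect : ∀ k l F → suc k * F + suc l * F ≡ suc (k + suc l) * F
    collect = solve-∀

  binom-trinomial-+ : ∀ b c d →
    binom (b + c + d) b * binom (c + d) c ≡ binom (b + c + d) (b + c) * binom (b + c) b
  binom-trinomial-+ b c d = *-cancelʳ-≡ _ _ (b ! * (c ! * d !))
      {{m*n≢0 _ _ {{b !≢0}} {{m*n≢0 _ _ {{c !≢0}} {{d !≢0}}}}}} (begin
    (binom (b + c + d) b * binom (c + d) c) * (b ! * (c ! * d !))
      ≡⟨ rearrangeˡ (binom (b + c + d) b) (binom (c + d) c) (b !) (c !) (d !) ⟩
    binom (b + c + d) b * (b ! * (binom (c + d) c * (c ! * d !)))
      ≡⟨ cong (λ z → binom (b + c + d) b * (b ! * z)) (binom-factorials c d) ⟩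
    binom (b + c + d) b * (b ! * (c + d) !)
      ≡⟨ cong (λ z → binom z b * (b ! * (c + d) !)) (+-assoc b c d) ⟩
    binom (b + (c + d)) b * (b ! * (c + d) !)
      ≡⟨ binom-factorials b (c + d) ⟩
    (b + (c + d)) !
      ≡⟨ cong _! (sym (+-assoc b c d)) ⟩
    (b + c + d) !
      ≡⟨ sym (binom-factorials (b + c) d) ⟩
    binom (b + c + d) (b + c) * ((b + c) ! * d !)
      ≡⟨ cong (λ z → binom (b + c + d) (b + c) * (z * d !)) (sym (binom-factorials b c)) ⟩
    binom (b + c + d) (b + c) * ((binom (b + c) b * (b ! * c !)) * d !)
      ≡⟨ sym (rearrangeʳ (binom (b + c + d) (b + c)) (binom (b + c) b) (b !) (c !) (d !)) ⟩
    (binom (b + c + d) (b + c) * binom (b + c) b) * (b ! * (c ! * d !)) ∎)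
    where
    open ≡-Reasoning
    rearrangeˡ : ∀ x y bf cf df → (x * y) * (bf * (cf * df)) ≡ x * (bf * (y * (cf * df)))
    rearrangeˡ = solve-∀
    rearrangeʳ : ∀ x y bf cf df → (x * y) * (bf * (cf * df)) ≡ x * ((y * (bf * cf)) * df)
    rearrangeʳ = solve-∀

  binom-trinomial : ∀ a b c → binom a b * binom (a ∸ b) c ≡ binom a (b + c) * binom (b + c) b
  binom-trinomial a b c with b + c ≤? a
  ... | yes b+c≤a = begin
    binom a b * binom (a ∸ b) c                   ≡⟨ cong (λ z → binom z b * binom (z ∸ b) c) (sym a≡b+c+d) ⟩
    binom (b + c + d) b * binom (b + c + d ∸ b) c ≡⟨ cong (λ z → binom (b + c + d) b * binom z c) b+c+d∸b≡c+d ⟩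
    binom (b + c + d) b * binom (c + d) c         ≡⟨ binom-trinomial-+ b c d ⟩
    binom (b + c + d) (b + c) * binom (b + c) b   ≡⟨ cong (λ z → binom z (b + c) * binom (b + c) b) a≡b+c+d ⟩
    binom a (b + c) * binom (b + c) b             ∎
    where
    open ≡-Reasoning
    d = a ∸ (b + c)
    a≡b+c+d : b + c + d ≡ a
    a≡b+c+d = m+[n∸m]≡n b+c≤a
    b+c+d∸b≡c+d : b + c + d ∸ b ≡ c + d
    b+c+d∸b≡c+d = trans (cong (_∸ b) (+-assoc b c d)) (m+n∸m≡n b (c + d))
  ... | no b+c≰a with b ≤? a
  ...   | yes b≤a = begin
    binom a b * binom (a ∸ b) c         ≡⟨ cong (binom a b *_) (binom-≡0 a∸b<c) ⟩
    binom a b * 0                       ≡⟨ *-zeroʳ (binom a b) ⟩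
    0                                   ≡⟨ cong (_* binom (b + c) b) (binom-≡0 (≰⇒> b+c≰a)) ⟨
    binom a (b + c) * binom (b + c) b   ∎
    where
    open ≡-Reasoning
    a∸b<c : a ∸ b < c
    a∸b<c = +-cancelʳ-< _ _ _ (subst (_< c + b) (sym (m∸n+n≡m b≤a)) (subst (a <_) (+-comm b c) (≰⇒> b+c≰a)))
  ...   | no b≰a =
    trans (cong (_* binom (a ∸ b) c) (binom-≡0 (≰⇒> b≰a))) (sym (cong (_* binom (b + c) b) (binom-≡0 (≰⇒> b+c≰a))))

  -- Words with prescribed descents

  -- wordCount u a S counts the words x₁ … x_k (k = length S) of distinct letters from an
  -- a-letter alphabet with x_i > x_{i-1} whenever the i-th entry of S is false, where x₀ is a
  -- virtual letter with exactly u letters above it: choosing x_i as the v-th largest of the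
  -- admissible letters leaves exactly v letters above it.
  wordCount : ℕ → ℕ → List Bool → ℕ
  wordCount u a []      = 1
  wordCount u a (c ∷ S) = sumBelow (if c then a else u) (λ v → wordCount v (a ∸ 1) S)

  -- Words of length 1 + length S whose descents lie in S; α (suc (length S)) S is the number
  -- of permutations with descent set contained in S.
  α : ℕ → List Bool → ℕ
  α a S = wordCount 0 a (true ∷ S)

  ascending : ℕ → List Bool
  ascending j = replicate j false

  wordCount-ascending : ∀ j u a → wordCount u a (ascending j) ≡ binom u j
  wordCount-ascending zero    u a = refl
  wordCount-ascending (suc j) u a =
    trans (sumBelow-cong u (λ v → wordCount-ascending j v (a ∸ 1))) (hockey-stick u j)

  α-ascending : ∀ j a → α a (ascending j) ≡ binom a (suc j)
  α-ascending j a = trans (sumBelow-cong a (λ v → wordCount-ascending j v (a ∸ 1))) (hockey-stick a j)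

  α-ascending-diag : ∀ k → α (suc k) (ascending k) ≡ 1
  α-ascending-diag k = trans (α-ascending k (suc k)) (binom-diag (suc k))

  wordCount-++ : ∀ S T u a → wordCount u a (S ++ true ∷ T) ≡ wordCount u a S * α (a ∸ length S) T
  wordCount-++ []      T u a = sym (+-identityʳ _)
  wordCount-++ (c ∷ S) T u a = begin
    sumBelow (if c then a else u) (λ v → wordCount v (a ∸ 1) (S ++ true ∷ T))
      ≡⟨ sumBelow-cong (if c then a else u) (λ v → trans (wordCount-++ S T v (a ∸ 1))
           (cong (λ z → wordCount v (a ∸ 1) S * α z T) (∸-+-assoc a 1 (length S)))) ⟩
    sumBelow (if c then a else u) (λ v → wordCount v (a ∸ 1) S * α (a ∸ suc (length S)) T)
      ≡⟨ sumBelow-*ʳ (if c then a else u) (λ v → wordCount v (a ∸ 1) S) (α (a ∸ suc (length S)) T) ⟩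
    wordCount u a (c ∷ S) * α (a ∸ suc (length S)) T ∎
    where open ≡-Reasoning

  α-ascending-++ : ∀ j T a → α a (ascending j ++ true ∷ T) ≡ binom a (suc j) * α (a ∸ suc j) T
  α-ascending-++ j T a = trans (wordCount-++ (true ∷ ascending j) T 0 a)
    (cong₂ (λ x y → x * α (a ∸ suc y) T) (α-ascending j a) (length-replicate j))

  -- A word with descents in S is a choice of its set of letters followed by a permutation
  -- of that set with descents in S.
  α-split : ∀ S a → α a S ≡ binom a (suc (length S)) * α (suc (length S)) S
  α-split S = splits-ascending-++ S 0
    where
    Splits : List Bool → Set
    Splits S = ∀ a → α a S ≡ binom a (suc (length S)) * α (suc (length S)) S

    splits-ascending : ∀ j → Splits (ascending j)
    splits-ascending j a = begin
      α a (ascending j)                        ≡⟨ α-ascending j a ⟩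
      binom a (suc j)                          ≡⟨ *-identityʳ _ ⟨
      binom a (suc j) * 1                      ≡⟨ cong (binom a (suc j) *_) (α-ascending-diag j) ⟨
      binom a (suc j) * α (suc j) (ascending j)
        ≡⟨ cong (λ z → binom a (suc z) * α (suc z) (ascending j)) (length-replicate j) ⟨
      binom a (suc (length (ascending j))) * α (suc (length (ascending j))) (ascending j) ∎
      where open ≡-Reasoning

    length-ascending-++ : ∀ j T → length (ascending j ++ true ∷ T) ≡ j + suc (length T)
    length-ascending-++ j T = trans (length-++ (ascending j)) (cong (_+ suc (length T)) (length-replicate j))

    splits-ascending-++ : ∀ S j → Splits (ascending j ++ S)
    splits-ascending-++ []          j = subst Splits (sym (++-identityʳ (ascending j))) (splits-ascending j)
    splits-ascending-++ (false ∷ S) j = subst Splits (ascending-∷ʳ j S) (splits-ascending-++ S (suc j))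
      where
      ascending-∷ʳ : ∀ j S → ascending (suc j) ++ S ≡ ascending j ++ false ∷ S
      ascending-∷ʳ zero    S = refl
      ascending-∷ʳ (suc j) S = cong (false ∷_) (ascending-∷ʳ j S)
    splits-ascending-++ (true ∷ T) j a = begin
      α a (ascending j ++ true ∷ T)
        ≡⟨ α-ascending-++ j T a ⟩
      binom a (suc j) * α (a ∸ suc j) T
        ≡⟨ cong (binom a (suc j) *_) (splits-ascending-++ T 0 (a ∸ suc j)) ⟩
      binom a (suc j) * (binom (a ∸ suc j) (suc (length T)) * α (suc (length T)) T)
        ≡⟨ *-assoc (binom a (suc j)) _ _ ⟨
      (binom a (suc j) * binom (a ∸ suc j) (suc (length T))) * α (suc (length T)) T
        ≡⟨ cong (_* α (suc (length T)) T) (binom-trinomial a (suc j) (suc (length T))) ⟩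
      (binom a s * binom s (suc j)) * α (suc (length T)) T
        ≡⟨ *-assoc (binom a s) _ _ ⟩
      binom a s * (binom s (suc j) * α (suc (length T)) T)
        ≡⟨ cong (λ z → binom a s * (binom s (suc j) * α z T)) (m+n∸m≡n (suc j) (suc (length T))) ⟨
      binom a s * (binom s (suc j) * α (s ∸ suc j) T)
        ≡⟨ cong (binom a s *_) (α-ascending-++ j T s) ⟨
      binom a s * α s (ascending j ++ true ∷ T)
        ≡⟨ cong (λ z → binom a (suc z) * α (suc z) (ascending j ++ true ∷ T)) (length-ascending-++ j T) ⟨
      binom a (suc (length (ascending j ++ true ∷ T))) * α (suc (length (ascending j ++ true ∷ T)))
        (ascending j ++ true ∷ T) ∎
      where
      open ≡-Reasoning
      s = suc j + suc (length T)

  α-++-ascending : ∀ S k r → r ≡ suc (length S) + suc k →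
    α r (S ++ true ∷ ascending k) ≡ binom r (suc (length S)) * α (suc (length S)) S
  α-++-ascending S k r r≡ = begin
    α r (S ++ true ∷ ascending k)                  ≡⟨ wordCount-++ (true ∷ S) (ascending k) 0 r ⟩
    α r S * α (r ∸ suc (length S)) (ascending k)   ≡⟨ cong (λ z → α r S * α z (ascending k)) r∸|S|≡1+k ⟩
    α r S * α (suc k) (ascending k)                ≡⟨ cong (α r S *_) (α-ascending-diag k) ⟩
    α r S * 1                                      ≡⟨ *-identityʳ _ ⟩
    α r S                                          ≡⟨ α-split S r ⟩
    binom r (suc (length S)) * α (suc (length S)) S ∎
    where
    open ≡-Reasoning
    r∸|S|≡1+k : r ∸ suc (length S) ≡ suc k
    r∸|S|≡1+k = trans (cong (_∸ suc (length S)) r≡) (m+n∸m≡n (suc (length S)) (suc k))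

  module _ {N : ℕ} where

    _<ᶠ_ : Fin N → Fin N → Bool
    x <ᶠ y = toℕ x <ᵇ toℕ y

    _∖ᶠ_ : (Fin N → Bool) → Fin N → Fin N → Bool
    (A ∖ᶠ x) y = A y ∧ not (eqFin y x)

    Sorted : List (Fin N) → Set
    Sorted = AllPairs (λ x y → (x <ᶠ y) ≡ true)

    admissible : {k : ℕ} → (Fin N → Bool) → Fin N → List Bool → Vec (Fin N) k → Bool
    admissible A lb S       []      = true
    admissible A lb []      (x ∷ w) = false
    admissible A lb (c ∷ S) (x ∷ w) = (A x ∧ (c ∨ lb <ᶠ x)) ∧ admissible (A ∖ᶠ x) x S w

    -- In a sorted list the P-letters have 0, 1, …, countᵇ P L - 1 P-letters above them.
    sum-over-ranks : (L : List (Fin N)) → Sorted L → (P : Fin N → Bool) (f : ℕ → ℕ) →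
      sum (map (λ x → if P x then f (countᵇ (λ y → P y ∧ x <ᶠ y) L) else 0) L) ≡ sumBelow (countᵇ P L) f
    sum-over-ranks []       _            P f = refl
    sum-over-ranks (x ∷ L) (x<L ∷ sorted) P f = begin
      (if P x then f (countᵇ (above x) (x ∷ L)) else 0) + sum (map (term (x ∷ L)) L)
        ≡⟨ cong₂ _+_ (cong (λ z → if P x then f z else 0) count-above-x) (sum-map-cong _ _ L drop-x) ⟩
      (if P x then f (countᵇ P L) else 0) + sum (map (term L) L)
        ≡⟨ cong (_+_ (if P x then f (countᵇ P L) else 0)) (sum-over-ranks L sorted P f) ⟩
      (if P x then f (countᵇ P L) else 0) + sumBelow (countᵇ P L) f
        ≡⟨ add-top (P x) (countᵇ P L) ⟩
      sumBelow (if P x then suc (countᵇ P L) else countᵇ P L) f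
        ≡⟨ cong (λ z → sumBelow z f) (countᵇ-∷ P x L) ⟨
      sumBelow (countᵇ P (x ∷ L)) f ∎
      where
      open ≡-Reasoning
      above : Fin N → Fin N → Bool
      above z y = P y ∧ z <ᶠ y
      term : List (Fin N) → Fin N → ℕ
      term M z = if P z then f (countᵇ (above z) M) else 0
      count-above-x : countᵇ (above x) (x ∷ L) ≡ countᵇ P L
      count-above-x rewrite <ᵇ-irrefl (toℕ x) | ∧-zeroʳ (P x) =
        countᵇ-cong (above x) P L (λ {y} y∈L → trans (cong (P y ∧_) (All.lookup x<L y∈L)) (∧-identityʳ (P y)))
      drop-x : ∀ {z} → z ∈ L → term (x ∷ L) z ≡ term L z
      drop-x {z} z∈L rewrite <ᵇ-asym (toℕ x) (toℕ z) (All.lookup x<L z∈L) | ∧-zeroʳ (P x) = refl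
      add-top : ∀ b c → (if b then f c else 0) + sumBelow c f ≡ sumBelow (if b then suc c else c) f
      add-top true  c = +-comm (f c) _
      add-top false c = refl

    countᵇ-∖ᶠ : (L : List (Fin N)) → Sorted L → (A : Fin N → Bool) → ∀ {x} → x ∈ L → A x ≡ true →
      suc (countᵇ (A ∖ᶠ x) L) ≡ countᵇ A L
    countᵇ-∖ᶠ (x ∷ L) (x<L ∷ _) A (here refl) Ax = begin
      suc (countᵇ (A ∖ᶠ x) (x ∷ L))                            ≡⟨ cong suc (countᵇ-∷ (A ∖ᶠ x) x L) ⟩
      suc (if (A ∖ᶠ x) x then suc (countᵇ (A ∖ᶠ x) L) else countᵇ (A ∖ᶠ x) L)        ≡⟨ cong suc x∉A∖x ⟩
      suc (countᵇ (A ∖ᶠ x) L)                                  ≡⟨ cong suc (countᵇ-cong _ _ L L⊆A∖x) ⟩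
      suc (countᵇ A L)                                         ≡⟨ cong (λ b → if b then suc (countᵇ A L) else countᵇ A L) Ax ⟨
      (if A x then suc (countᵇ A L) else countᵇ A L)           ≡⟨ countᵇ-∷ A x L ⟨
      countᵇ A (x ∷ L)                                         ∎
      where
      open ≡-Reasoning
      x∉A∖x : (if (A ∖ᶠ x) x then suc (countᵇ (A ∖ᶠ x) L) else countᵇ (A ∖ᶠ x) L) ≡ countᵇ (A ∖ᶠ x) L
      x∉A∖x rewrite ≡ᵇ-refl (toℕ x) | ∧-zeroʳ (A x) = refl
      L⊆A∖x : ∀ {y} → y ∈ L → (A ∖ᶠ x) y ≡ A y
      L⊆A∖x {y} y∈L = trans (cong (λ b → A y ∧ not b) (<ᵇ⇒≡ᵇ≡false (toℕ x) (toℕ y) (All.lookup x<L y∈L)))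
                            (∧-identityʳ (A y))
    countᵇ-∖ᶠ (y ∷ L) (y<L ∷ sorted) A {x} (there x∈L) Ax = begin
      suc (countᵇ (A ∖ᶠ x) (y ∷ L))                                   ≡⟨ cong suc (countᵇ-∷ (A ∖ᶠ x) y L) ⟩
      suc (if (A ∖ᶠ x) y then suc (countᵇ (A ∖ᶠ x) L) else countᵇ (A ∖ᶠ x) L)
        ≡⟨ cong (λ b → suc (if b then suc (countᵇ (A ∖ᶠ x) L) else countᵇ (A ∖ᶠ x) L)) y∈A∖x ⟩
      suc (if A y then suc (countᵇ (A ∖ᶠ x) L) else countᵇ (A ∖ᶠ x) L) ≡⟨ step (A y) ⟩
      (if A y then suc (countᵇ A L) else countᵇ A L)                   ≡⟨ countᵇ-∷ A y L ⟨
      countᵇ A (y ∷ L)                                                 ∎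
      where
      open ≡-Reasoning
      y∈A∖x : (A ∖ᶠ x) y ≡ A y
      y∈A∖x = trans (cong (λ b → A y ∧ not b) (trans (≡ᵇ-sym (toℕ y) (toℕ x))
                      (<ᵇ⇒≡ᵇ≡false (toℕ y) (toℕ x) (All.lookup y<L x∈L)))) (∧-identityʳ (A y))
      step : ∀ b → suc (if b then suc (countᵇ (A ∖ᶠ x) L) else countᵇ (A ∖ᶠ x) L)
                 ≡ (if b then suc (countᵇ A L) else countᵇ A L)
      step true  = cong suc (countᵇ-∖ᶠ L sorted A x∈L Ax)
      step false = countᵇ-∖ᶠ L sorted A x∈L Ax

    ∖ᶠ-above : ∀ A lb c x y → (A x ∧ (c ∨ lb <ᶠ x)) ≡ true →
      ((A ∖ᶠ x) y ∧ x <ᶠ y) ≡ ((A y ∧ (c ∨ lb <ᶠ y)) ∧ x <ᶠ y)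
    ∖ᶠ-above A lb c x y x-ok with x <ᶠ y in x<y
    ... | false = trans (∧-zeroʳ _) (sym (∧-zeroʳ _))
    ... | true  = begin
      (A y ∧ not (eqFin y x)) ∧ true  ≡⟨ ∧-identityʳ _ ⟩
      A y ∧ not (eqFin y x)           ≡⟨ cong (λ b → A y ∧ not b) (<ᵇ⇒≡ᵇ≡false (toℕ x) (toℕ y) x<y) ⟩
      A y ∧ true                      ≡⟨ cong (A y ∧_) (lb<y c (∧-true⁻ʳ (A x) _ x-ok)) ⟨
      A y ∧ (c ∨ lb <ᶠ y)             ≡⟨ ∧-identityʳ _ ⟨
      (A y ∧ (c ∨ lb <ᶠ y)) ∧ true    ∎
      where
      open ≡-Reasoning
      lb<y : ∀ c → (c ∨ lb <ᶠ x) ≡ true → (c ∨ lb <ᶠ y) ≡ true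
      lb<y true  _    = refl
      lb<y false lb<x = <ᵇ-trans (toℕ lb) (toℕ x) (toℕ y) lb<x x<y

    count-admissible : (L : List (Fin N)) → Sorted L → ∀ k (S : List Bool) → length S ≡ k →
      (A : Fin N → Bool) (lb : Fin N) →
      countᵇ (admissible A lb S) (allVecs L k) ≡ wordCount (countᵇ (λ y → A y ∧ lb <ᶠ y) L) (countᵇ A L) S
    count-admissible L sorted zero    []      _ A lb = refl
    count-admissible L sorted (suc k) (c ∷ S) |S|≡1+k A lb = begin
      countᵇ (admissible A lb (c ∷ S)) (allVecs L (suc k))
        ≡⟨ countᵇ-concatMap (admissible A lb (c ∷ S)) (λ x → map (x ∷_) (allVecs L k)) L ⟩
      sum (map (λ x → countᵇ (admissible A lb (c ∷ S)) (map (x ∷_) (allVecs L k))) L)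
        ≡⟨ sum-map-cong _ _ L (λ {x} _ → trans (countᵇ-map (admissible A lb (c ∷ S)) (x ∷_) (allVecs L k))
                                                (countᵇ-∧ˡ (P x) (admissible (A ∖ᶠ x) x S) (allVecs L k))) ⟩
      sum (map (λ x → if P x then countᵇ (admissible (A ∖ᶠ x) x S) (allVecs L k) else 0) L)
        ≡⟨ sum-map-cong _ _ L recurse ⟩
      sum (map (λ x → if P x then wordCount (countᵇ (λ y → P y ∧ x <ᶠ y) L) (countᵇ A L ∸ 1) S else 0) L)
        ≡⟨ sum-over-ranks L sorted P (λ v → wordCount v (countᵇ A L ∸ 1) S) ⟩
      sumBelow (countᵇ P L) (λ v → wordCount v (countᵇ A L ∸ 1) S)
        ≡⟨ first-letter c ⟩
      wordCount (countᵇ (λ y → A y ∧ lb <ᶠ y) L) (countᵇ A L) (c ∷ S) ∎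
      where
      open ≡-Reasoning
      P : Fin N → Bool
      P x = A x ∧ (c ∨ lb <ᶠ x)
      recurse : ∀ {x} → x ∈ L →
        (if P x then countᵇ (admissible (A ∖ᶠ x) x S) (allVecs L k) else 0) ≡
        (if P x then wordCount (countᵇ (λ y → P y ∧ x <ᶠ y) L) (countᵇ A L ∸ 1) S else 0)
      recurse {x} x∈L with P x in Px
      ... | false = refl
      ... | true  = trans (count-admissible L sorted k S (suc-injective |S|≡1+k) (A ∖ᶠ x) x)
                      (cong₂ (λ u a → wordCount u a S) (countᵇ-cong _ _ L (λ {y} _ → ∖ᶠ-above A lb c x y Px))
                        (cong (_∸ 1) (countᵇ-∖ᶠ L sorted A x∈L (∧-true⁻ˡ (A x) _ Px))))
      first-letter : ∀ c → sumBelow (countᵇ (λ x → A x ∧ (c ∨ lb <ᶠ x)) L) (λ v → wordCount v (countᵇ A L ∸ 1) S)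
                           ≡ wordCount (countᵇ (λ y → A y ∧ lb <ᶠ y) L) (countᵇ A L) (c ∷ S)
      first-letter true  = cong (λ z → sumBelow z (λ v → wordCount v (countᵇ A L ∸ 1) S))
                                (countᵇ-cong _ _ L (λ {y} _ → ∧-identityʳ (A y)))
      first-letter false = refl

  allᶠ : {m : ℕ} → (Fin m → Bool) → Bool
  allᶠ {zero}  g = true
  allᶠ {suc m} g = g fzero ∧ allᶠ (g ∘ fsuc)

  allᶠ-cong : {m : ℕ} {f g : Fin m → Bool} → (∀ i → f i ≡ g i) → allᶠ f ≡ allᶠ g
  allᶠ-cong {zero}  h = refl
  allᶠ-cong {suc m} h = cong₂ _∧_ (h fzero) (allᶠ-cong (h ∘ fsuc))

  allᶠ-true : {m : ℕ} → allᶠ {m} (λ _ → true) ≡ true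
  allᶠ-true {zero}  = refl
  allᶠ-true {suc m} = allᶠ-true {m}

  allᶠ-∧ : {m : ℕ} (f g : Fin m → Bool) → allᶠ (λ i → f i ∧ g i) ≡ allᶠ f ∧ allᶠ g
  allᶠ-∧ {zero}  f g = refl
  allᶠ-∧ {suc m} f g = trans (cong ((f fzero ∧ g fzero) ∧_) (allᶠ-∧ (f ∘ fsuc) (g ∘ fsuc)))
                             (∧-interchange (f fzero) (g fzero) _ _)

  allᵥ-tabulate : {m : ℕ} (p : A → Bool) (f : Fin m → A) → allᵥ p (Vec.tabulate f) ≡ allᶠ (p ∘ f)
  allᵥ-tabulate {m = zero}  p f = refl
  allᵥ-tabulate {m = suc m} p f = cong (p (f fzero) ∧_) (allᵥ-tabulate p (f ∘ fsuc))

  allᵥ-allFin : {m : ℕ} (p : Fin m → Bool) → allᵥ p (allFin m) ≡ allᶠ p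
  allᵥ-allFin p = allᵥ-tabulate p (λ i → i)

  allᵥ-lookup : {m : ℕ} (p : A → Bool) (w : Vec A m) → allᵥ p w ≡ allᶠ (p ∘ lookup w)
  allᵥ-lookup p []      = refl
  allᵥ-lookup p (x ∷ w) = cong (p x ∧_) (allᵥ-lookup p w)

  allᵥ-∧ : {m : ℕ} (p q : A → Bool) (w : Vec A m) → allᵥ (λ y → p y ∧ q y) w ≡ allᵥ p w ∧ allᵥ q w
  allᵥ-∧ p q []      = refl
  allᵥ-∧ p q (x ∷ w) = trans (cong ((p x ∧ q x) ∧_) (allᵥ-∧ p q w)) (∧-interchange (p x) (q x) _ _)

  allᵥ-true : {m : ℕ} (w : Vec A m) → allᵥ (λ _ → true) w ≡ true
  allᵥ-true []      = refl
  allᵥ-true (x ∷ w) = allᵥ-true w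

  sorted-tabulate : {N m : ℕ} (f : Fin m → Fin N) → (∀ i j → toℕ i < toℕ j → (f i <ᶠ f j) ≡ true) →
    Sorted (Vec.toList (Vec.tabulate f))
  sorted-tabulate {m = zero}  f f-mono = []
  sorted-tabulate {m = suc m} f f-mono =
    above-head (f ∘ fsuc) (λ i → f-mono fzero (fsuc i) (s≤s z≤n)) ∷
    sorted-tabulate (f ∘ fsuc) (λ i j i<j → f-mono (fsuc i) (fsuc j) (s≤s i<j))
    where
    above-head : {k : ℕ} (g : Fin k → Fin _) → (∀ i → (f fzero <ᶠ g i) ≡ true) →
      All (λ y → (f fzero <ᶠ y) ≡ true) (Vec.toList (Vec.tabulate g))
    above-head {zero}  g h = []
    above-head {suc k} g h = h fzero ∷ above-head (g ∘ fsuc) (h ∘ fsuc)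

  sorted-allFin : (n : ℕ) → Sorted (Vec.toList (allFin n))
  sorted-allFin n = sorted-tabulate (λ i → i) (λ i j → <⇒<ᵇ≡true)

  module _ {N : ℕ} where

    distinct : {k : ℕ} → Vec (Fin N) k → Bool
    distinct []      = true
    distinct (x ∷ w) = allᵥ (λ y → not (eqFin y x)) w ∧ distinct w

    injectiveᵇ : {k : ℕ} → Vec (Fin N) k → Bool
    injectiveᵇ σ = allᶠ (λ i → allᶠ (λ j → eqFin i j ∨ not (eqFin (lookup σ i) (lookup σ j))))

    injectiveᵇ≡distinct : {k : ℕ} (σ : Vec (Fin N) k) → injectiveᵇ σ ≡ distinct σ
    injectiveᵇ≡distinct []      = refl
    injectiveᵇ≡distinct (x ∷ w) = begin
      allᶠ (λ j → not (eqFin x (lookup w j))) ∧ allᶠ (λ i → not (eqFin (lookup w i) x) ∧ _)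
        ≡⟨ cong (allᶠ (λ j → not (eqFin x (lookup w j))) ∧_) (allᶠ-∧ (λ i → not (eqFin (lookup w i) x)) _) ⟩
      allᶠ (λ j → not (eqFin x (lookup w j))) ∧ (x∉w ∧ injectiveᵇ w)
        ≡⟨ cong (_∧ (x∉w ∧ injectiveᵇ w)) (allᶠ-cong (λ j → cong not (≡ᵇ-sym (toℕ x) (toℕ (lookup w j))))) ⟩
      x∉w ∧ (x∉w ∧ injectiveᵇ w)
        ≡⟨ ∧-assoc x∉w x∉w _ ⟨
      (x∉w ∧ x∉w) ∧ injectiveᵇ w
        ≡⟨ cong₂ _∧_ (trans (∧-idem x∉w) (sym (allᵥ-lookup (λ y → not (eqFin y x)) w))) (injectiveᵇ≡distinct w) ⟩
      allᵥ (λ y → not (eqFin y x)) w ∧ distinct w ∎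
      where
      open ≡-Reasoning
      x∉w = allᶠ (λ i → not (eqFin (lookup w i) x))

    ascentsOutside : {k : ℕ} → Fin N → List Bool → Vec (Fin N) k → Bool
    ascentsOutside lb S       []      = true
    ascentsOutside lb []      (x ∷ w) = false
    ascentsOutside lb (c ∷ S) (x ∷ w) = (c ∨ lb <ᶠ x) ∧ ascentsOutside x S w

    admissible≡ : {k : ℕ} (A : Fin N → Bool) (lb : Fin N) (S : List Bool) (w : Vec (Fin N) k) →
      admissible A lb S w ≡ allᵥ A w ∧ (distinct w ∧ ascentsOutside lb S w)
    admissible≡ A lb S       []      = refl
    admissible≡ A lb []      (x ∷ w) = sym (trans (cong ((A x ∧ allᵥ A w) ∧_) (∧-zeroʳ _)) (∧-zeroʳ _))
    admissible≡ A lb (c ∷ S) (x ∷ w) = begin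
      (A x ∧ (c ∨ lb <ᶠ x)) ∧ admissible (A ∖ᶠ x) x S w
        ≡⟨ cong ((A x ∧ (c ∨ lb <ᶠ x)) ∧_) (admissible≡ (A ∖ᶠ x) x S w) ⟩
      (A x ∧ (c ∨ lb <ᶠ x)) ∧ (allᵥ (A ∖ᶠ x) w ∧ (distinct w ∧ ascentsOutside x S w))
        ≡⟨ cong (λ z → (A x ∧ (c ∨ lb <ᶠ x)) ∧ (z ∧ (distinct w ∧ ascentsOutside x S w)))
                (allᵥ-∧ A (λ y → not (eqFin y x)) w) ⟩
      (A x ∧ (c ∨ lb <ᶠ x)) ∧ ((allᵥ A w ∧ x∉w) ∧ (distinct w ∧ ascentsOutside x S w))
        ≡⟨ rearrange (A x) (c ∨ lb <ᶠ x) (allᵥ A w) x∉w (distinct w) (ascentsOutside x S w) ⟩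
      (A x ∧ allᵥ A w) ∧ ((x∉w ∧ distinct w) ∧ ((c ∨ lb <ᶠ x) ∧ ascentsOutside x S w)) ∎
      where
      open ≡-Reasoning
      x∉w = allᵥ (λ y → not (eqFin y x)) w
      rearrange : ∀ a e b n d o → (a ∧ e) ∧ ((b ∧ n) ∧ (d ∧ o)) ≡ (a ∧ b) ∧ ((n ∧ d) ∧ (e ∧ o))
      rearrange false e     b     n     d     o = refl
      rearrange true  false false n     d     o = refl
      rearrange true  false true  false d     o = refl
      rearrange true  false true  true  false o = refl
      rearrange true  false true  true  true  o = refl
      rearrange true  true  false n     d     o = refl
      rearrange true  true  true  false d     o = refl
      rearrange true  true  true  true  d     o = refl

    ascentsOutside-tabulate : {m : ℕ} (S : Fin m → Bool) (x : Fin N) (w : Vec (Fin N) m) →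
      ascentsOutside x (tabulate S) w ≡ allᶠ (λ i → S i ∨ (lookup (x ∷ w) (inject₁ i) <ᶠ lookup (x ∷ w) (fsuc i)))
    ascentsOutside-tabulate {zero}  S x []      = refl
    ascentsOutside-tabulate {suc m} S x (y ∷ w) = cong ((S fzero ∨ x <ᶠ y) ∧_) (ascentsOutside-tabulate (S ∘ fsuc) y w)

  permutations : (n : ℕ) → List (Word n)
  permutations n = filterᵇ isPerm (allVecs (Vec.toList (allFin n)) n)

  -- S i = true allows a descent at position i + 1.
  count-permutations-descents⊆ : ∀ m (S : Fin m → Bool) →
    countᵇ (λ σ → allᶠ (λ i → S i ∨ isAscent σ i)) (permutations (suc m)) ≡ α (suc m) (tabulate S)
  count-permutations-descents⊆ m S = begin
    countᵇ descents⊆S (filterᵇ isPerm (allVecs L (suc m)))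
      ≡⟨ cong length (filterᵇ-filterᵇ descents⊆S isPerm (allVecs L (suc m))) ⟩
    countᵇ (λ σ → isPerm σ ∧ descents⊆S σ) (allVecs L (suc m))
      ≡⟨ countᵇ-cong _ _ (allVecs L (suc m)) (λ {σ} _ → as-admissible σ) ⟩
    countᵇ (admissible (λ _ → true) fzero (true ∷ tabulate S)) (allVecs L (suc m))
      ≡⟨ count-admissible L (sorted-allFin (suc m)) (suc m) (true ∷ tabulate S) (cong suc (length-tabulate S))
                           (λ _ → true) fzero ⟩
    α (countᵇ (λ _ → true) L) (tabulate S)
      ≡⟨ cong (λ a → α a (tabulate S)) (trans (countᵇ-true L) (Vec.length-toList (allFin (suc m)))) ⟩
    α (suc m) (tabulate S) ∎
    where
    open ≡-Reasoning
    L = Vec.toList (allFin (suc m))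
    descents⊆S : Word (suc m) → Bool
    descents⊆S σ = allᶠ (λ i → S i ∨ isAscent σ i)
    isPerm≡distinct : (σ : Word (suc m)) → isPerm σ ≡ distinct σ
    isPerm≡distinct σ = trans (trans (allᵥ-allFin (λ i → allᵥ (different i) (allFin (suc m)))) (allᶠ-cong (λ i → allᵥ-allFin (λ j → different i j))))
                               (injectiveᵇ≡distinct σ)
      where
      different : Fin (suc m) → Fin (suc m) → Bool
      different i j = eqFin i j ∨ not (eqFin (lookup σ i) (lookup σ j))
    as-admissible : (σ : Word (suc m)) → (isPerm σ ∧ descents⊆S σ) ≡ admissible (λ _ → true) fzero (true ∷ tabulate S) σ
    as-admissible (x ∷ w) = sym (begin
      admissible (λ _ → true) fzero (true ∷ tabulate S) (x ∷ w)
        ≡⟨ admissible≡ (λ _ → true) fzero (true ∷ tabulate S) (x ∷ w) ⟩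
      allᵥ (λ _ → true) (x ∷ w) ∧ (distinct (x ∷ w) ∧ ascentsOutside fzero (true ∷ tabulate S) (x ∷ w))
        ≡⟨ cong (_∧ (distinct (x ∷ w) ∧ ascentsOutside x (tabulate S) w)) (allᵥ-true (x ∷ w)) ⟩
      distinct (x ∷ w) ∧ ascentsOutside x (tabulate S) w
        ≡⟨ cong₂ _∧_ (sym (isPerm≡distinct (x ∷ w))) (ascentsOutside-tabulate S x w) ⟩
      isPerm (x ∷ w) ∧ descents⊆S (x ∷ w) ∎)

  -- Tuples of permutations and inclusion–exclusion

  allZipᵥ : {t : ℕ} → Vec (A → Bool) t → Vec A t → Bool
  allZipᵥ []       []       = true
  allZipᵥ (q ∷ qs) (z ∷ zs) = q z ∧ allZipᵥ qs zs

  countᵇ-allVecs-allZipᵥ : (L : List A) → ∀ t (qs : Vec (A → Bool) t) →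
    countᵇ (allZipᵥ qs) (allVecs L t) ≡ Vec.foldr (λ _ → ℕ) (λ q n → countᵇ q L * n) 1 qs
  countᵇ-allVecs-allZipᵥ L zero    []       = refl
  countᵇ-allVecs-allZipᵥ L (suc t) (q ∷ qs) = begin
    countᵇ (allZipᵥ (q ∷ qs)) (concatMap (λ a → map (a ∷_) (allVecs L t)) L)
      ≡⟨ countᵇ-concatMap (allZipᵥ (q ∷ qs)) (λ a → map (a ∷_) (allVecs L t)) L ⟩
    sum (map (λ a → countᵇ (allZipᵥ (q ∷ qs)) (map (a ∷_) (allVecs L t))) L)
      ≡⟨ sum-map-cong _ _ L (λ {a} _ → trans (countᵇ-map (allZipᵥ (q ∷ qs)) (a ∷_) (allVecs L t))
                                             (countᵇ-∧ˡ (q a) (allZipᵥ qs) (allVecs L t))) ⟩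
    sum (map (λ a → if q a then countᵇ (allZipᵥ qs) (allVecs L t) else 0) L)
      ≡⟨ sum-map-if q _ L ⟩
    countᵇ q L * countᵇ (allZipᵥ qs) (allVecs L t)
      ≡⟨ cong (countᵇ q L *_) (countᵇ-allVecs-allZipᵥ L t qs) ⟩
    countᵇ q L * Vec.foldr (λ _ → ℕ) (λ q n → countᵇ q L * n) 1 qs ∎
    where open ≡-Reasoning

  countᵇ-allVecs-allᵥ : (L : List A) (q : A → Bool) (t : ℕ) → countᵇ (allᵥ q) (allVecs L t) ≡ countᵇ q L ^ t
  countᵇ-allVecs-allᵥ L q t = begin
    countᵇ (allᵥ q) (allVecs L t)                           ≡⟨ countᵇ-cong _ _ (allVecs L t) (λ {τ} _ → allᵥ≡allZipᵥ τ) ⟩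
    countᵇ (allZipᵥ (Vec.replicate t q)) (allVecs L t)      ≡⟨ countᵇ-allVecs-allZipᵥ L t (Vec.replicate t q) ⟩
    Vec.foldr (λ _ → ℕ) (λ q n → countᵇ q L * n) 1 (Vec.replicate t q) ≡⟨ product-replicate t ⟩
    countᵇ q L ^ t                                          ∎
    where
    open ≡-Reasoning
    allᵥ≡allZipᵥ : {t : ℕ} (τ : Vec _ t) → allᵥ q τ ≡ allZipᵥ (Vec.replicate t q) τ
    allᵥ≡allZipᵥ []      = refl
    allᵥ≡allZipᵥ (z ∷ τ) = cong (q z ∧_) (allᵥ≡allZipᵥ τ)
    product-replicate : ∀ t → Vec.foldr (λ _ → ℕ) (λ q n → countᵇ q L * n) 1 (Vec.replicate t q) ≡ countᵇ q L ^ t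
    product-replicate zero    = refl
    product-replicate (suc t) = cong (countᵇ q L *_) (product-replicate t)

  allᶠ-∨-allᵥ : {m t : ℕ} (S : Fin m → Bool) (f : A → Fin m → Bool) (τ : Vec A t) →
    allᶠ (λ i → S i ∨ allᵥ (λ σ → f σ i) τ) ≡ allᵥ (λ σ → allᶠ (λ i → S i ∨ f σ i)) τ
  allᶠ-∨-allᵥ {m = m} S f [] = trans (allᶠ-cong (λ i → ∨-zeroʳ (S i))) (allᶠ-true {m})
  allᶠ-∨-allᵥ S f (σ ∷ τ) = begin
    allᶠ (λ i → S i ∨ (f σ i ∧ allᵥ (λ σ′ → f σ′ i) τ))
      ≡⟨ allᶠ-cong (λ i → ∨-distribˡ-∧ (S i) (f σ i) _) ⟩
    allᶠ (λ i → (S i ∨ f σ i) ∧ (S i ∨ allᵥ (λ σ′ → f σ′ i) τ))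
      ≡⟨ allᶠ-∧ (λ i → S i ∨ f σ i) _ ⟩
    allᶠ (λ i → S i ∨ f σ i) ∧ allᶠ (λ i → S i ∨ allᵥ (λ σ′ → f σ′ i) τ)
      ≡⟨ cong (allᶠ (λ i → S i ∨ f σ i) ∧_) (allᶠ-∨-allᵥ S f τ) ⟩
    allᶠ (λ i → S i ∨ f σ i) ∧ allᵥ (λ σ′ → allᶠ (λ i → S i ∨ f σ′ i)) τ ∎
    where open ≡-Reasoning

  -- signedSum⊆ J f = Σ_{S ⊆ J} (-1)^{|J ∖ S|} f S, subsets of Fin m being predicates.
  signedSum⊆ : {m : ℕ} → (Fin m → Bool) → ((Fin m → Bool) → ℤ) → ℤ
  signedSum⊆ {zero}  J f = f (λ ())
  signedSum⊆ {suc m} J f = if J fzero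
    then signedSum⊆ (J ∘ fsuc) (λ S → f (true ∷ᶠ S)) -ℤ signedSum⊆ (J ∘ fsuc) (λ S → f (false ∷ᶠ S))
    else signedSum⊆ (J ∘ fsuc) (λ S → f (false ∷ᶠ S))

  signedSum⊆-cong : {m : ℕ} (J : Fin m → Bool) {f g : (Fin m → Bool) → ℤ} → (∀ S → f S ≡ g S) →
    signedSum⊆ J f ≡ signedSum⊆ J g
  signedSum⊆-cong {zero}  J h = h (λ ())
  signedSum⊆-cong {suc m} J h with J fzero
  ... | true  = cong₂ _-ℤ_ (signedSum⊆-cong (J ∘ fsuc) (h ∘ (true ∷ᶠ_))) (signedSum⊆-cong (J ∘ fsuc) (h ∘ (false ∷ᶠ_)))
  ... | false = signedSum⊆-cong (J ∘ fsuc) (h ∘ (false ∷ᶠ_))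

  signedSum⊆-neg : {m : ℕ} (J : Fin m → Bool) (f : (Fin m → Bool) → ℤ) →
    signedSum⊆ J (λ S → -ℤ f S) ≡ -ℤ signedSum⊆ J f
  signedSum⊆-neg {zero}  J f = refl
  signedSum⊆-neg {suc m} J f with J fzero
  ... | true  = trans (cong₂ _-ℤ_ (signedSum⊆-neg (J ∘ fsuc) (f ∘ (true ∷ᶠ_))) (signedSum⊆-neg (J ∘ fsuc) (f ∘ (false ∷ᶠ_))))
                      (neg-distrib-∸ (signedSum⊆ (J ∘ fsuc) (f ∘ (true ∷ᶠ_))) (signedSum⊆ (J ∘ fsuc) (f ∘ (false ∷ᶠ_))))
    where
    neg-distrib-∸ : ∀ a b → (-ℤ a) -ℤ (-ℤ b) ≡ -ℤ (a -ℤ b)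
    neg-distrib-∸ = ℤ-Solver.solve-∀
  ... | false = signedSum⊆-neg (J ∘ fsuc) (f ∘ (false ∷ᶠ_))

  countᵇ-∧-filterᵇ : (b p : A → Bool) (xs : List A) → countᵇ (λ x → b x ∧ p x) xs ≡ countᵇ p (filterᵇ b xs)
  countᵇ-∧-filterᵇ b p xs = sym (cong length (filterᵇ-filterᵇ p b xs))

  -- With c x i read as "i is a common ascent of x", this counts the x whose set of non-ascents is
  -- exactly J by those whose non-ascents lie in S, for S ⊆ J.
  inclusion-exclusion : {m : ℕ} (J : Fin m → Bool) (c : A → Fin m → Bool) (X : List A) →
    + countᵇ (λ x → allᶠ (λ i → allBoolean (c x i) (not (J i)))) X ≡
    signedSum⊆ J (λ S → + countᵇ (λ x → allᶠ (λ i → S i ∨ c x i)) X)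
  inclusion-exclusion {m = zero}  J c X = refl
  inclusion-exclusion {m = suc m} J c X with J fzero
  ... | false = begin
    + countᵇ (λ x → allBoolean (c₀ x) true ∧ R x) X
      ≡⟨ cong +_ (countᵇ-cong _ _ X (λ {x} _ → cong (_∧ R x) (allBoolean-true (c₀ x)))) ⟩
    + countᵇ (λ x → c₀ x ∧ R x) X
      ≡⟨ cong +_ (countᵇ-∧-filterᵇ c₀ R X) ⟩
    + countᵇ R (filterᵇ c₀ X)
      ≡⟨ inclusion-exclusion (J ∘ fsuc) c′ (filterᵇ c₀ X) ⟩
    signedSum⊆ (J ∘ fsuc) (λ S → + countᵇ (λ x → allᶠ (λ i → S i ∨ c′ x i)) (filterᵇ c₀ X))
      ≡⟨ signedSum⊆-cong (J ∘ fsuc) (λ S → cong +_ (sym (countᵇ-∧-filterᵇ c₀ _ X))) ⟩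
    signedSum⊆ (J ∘ fsuc) (λ S → + countᵇ (λ x → c₀ x ∧ allᶠ (λ i → S i ∨ c′ x i)) X) ∎
    where
    open ≡-Reasoning
    c₀ = λ x → c x fzero
    c′ = λ x → c x ∘ fsuc
    R = λ x → allᶠ (λ i → allBoolean (c′ x i) (not (J (fsuc i))))
  ... | true = begin
    + countᵇ (λ x → allBoolean (c₀ x) false ∧ R x) X
      ≡⟨ cong +_ (countᵇ-cong _ _ X (λ {x} _ → cong (_∧ R x) (allBoolean-false (c₀ x)))) ⟩
    + countᵇ (λ x → not (c₀ x) ∧ R x) X
      ≡⟨ +countᵇ-not c₀ R X ⟩
    + countᵇ R X -ℤ + countᵇ (λ x → c₀ x ∧ R x) X
      ≡⟨ cong₂ _-ℤ_ (inclusion-exclusion (J ∘ fsuc) c′ X)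
                    (trans (cong +_ (countᵇ-∧-filterᵇ c₀ R X)) (inclusion-exclusion (J ∘ fsuc) c′ (filterᵇ c₀ X))) ⟩
    signedSum⊆ (J ∘ fsuc) (λ S → + countᵇ (λ x → allᶠ (λ i → S i ∨ c′ x i)) X) -ℤ
    signedSum⊆ (J ∘ fsuc) (λ S → + countᵇ (λ x → allᶠ (λ i → S i ∨ c′ x i)) (filterᵇ c₀ X))
      ≡⟨ cong (_-ℤ_ (signedSum⊆ (J ∘ fsuc) (λ S → + countᵇ (λ x → allᶠ (λ i → S i ∨ c′ x i)) X)))
              (signedSum⊆-cong (J ∘ fsuc) (λ S → cong +_ (sym (countᵇ-∧-filterᵇ c₀ _ X)))) ⟩
    signedSum⊆ (J ∘ fsuc) (λ S → + countᵇ (λ x → allᶠ (λ i → S i ∨ c′ x i)) X) -ℤ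
    signedSum⊆ (J ∘ fsuc) (λ S → + countᵇ (λ x → c₀ x ∧ allᶠ (λ i → S i ∨ c′ x i)) X) ∎
    where
    open ≡-Reasoning
    c₀ = λ x → c x fzero
    c′ = λ x → c x ∘ fsuc
    R = λ x → allᶠ (λ i → allBoolean (c′ x i) (not (J (fsuc i))))

  count-common-ascents : ∀ t m (J : Fin m → Bool) →
    + countᵇ (λ τ → allᶠ (λ i → allBoolean (isCommonAscent τ i) (not (J i)))) (permTuples t (suc m))
    ≡ signedSum⊆ J (λ S → + (α (suc m) (tabulate S) ^ t))
  count-common-ascents t m J = trans (inclusion-exclusion J isCommonAscent (permTuples t (suc m)))
    (signedSum⊆-cong J (λ S → cong +_ (begin
      countᵇ (λ τ → allᶠ (λ i → S i ∨ isCommonAscent τ i)) (permTuples t (suc m))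
        ≡⟨ countᵇ-cong _ _ (permTuples t (suc m)) (λ {τ} _ → allᶠ-∨-allᵥ S isAscent τ) ⟩
      countᵇ (allᵥ (λ σ → allᶠ (λ i → S i ∨ isAscent σ i))) (allVecs (permutations (suc m)) t)
        ≡⟨ countᵇ-allVecs-allᵥ (permutations (suc m)) (λ σ → allᶠ (λ i → S i ∨ isAscent σ i)) t ⟩
      countᵇ (λ σ → allᶠ (λ i → S i ∨ isAscent σ i)) (permutations (suc m)) ^ t
        ≡⟨ cong (_^ t) (count-permutations-descents⊆ m S) ⟩
      α (suc m) (tabulate S) ^ t ∎)))
    where open ≡-Reasoning

  wJ≡signedSum⊆ : ∀ t m (J : Subset m) → + wJ t m J ≡ signedSum⊆ (lookup J) (λ S → + (α (suc m) (tabulate S) ^ t))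
  wJ≡signedSum⊆ t m J = trans
    (cong +_ (countᵇ-cong _ _ (permTuples t (suc m))
      (λ {τ} _ → allᵥ-allFin (λ i → allBoolean (isCommonAscent τ i) (not (lookup J i))))))
    (count-common-ascents t m (lookup J))

  w≡signedSum⊆ : ∀ t m → + w t (suc m) ≡ signedSum⊆ (λ (_ : Fin m) → true) (λ S → + (α (suc m) (tabulate S) ^ t))
  w≡signedSum⊆ t m = trans
    (cong +_ (countᵇ-cong _ _ (permTuples t (suc m))
      (λ {τ} _ → trans (allᵥ-allFin (λ i → not (isCommonAscent τ i))) (allᶠ-cong (λ i → sym (allBoolean-false (isCommonAscent τ i)))))))
    (count-common-ascents t m (λ _ → true))

  -- The Möbius recursion on ranks and its closed form

  #true : List Bool → ℕ
  #true []          = 0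
  #true (true ∷ S)  = suc (#true S)
  #true (false ∷ S) = #true S

  #true-∷ʳ : ∀ S b → #true (S ++ b ∷ []) ≡ (if b then suc (#true S) else #true S)
  #true-∷ʳ []          true  = refl
  #true-∷ʳ []          false = refl
  #true-∷ʳ (true ∷ S)  b with b | #true-∷ʳ S b
  ... | true  | e = cong suc e
  ... | false | e = cong suc e
  #true-∷ʳ (false ∷ S) b = #true-∷ʳ S b

  -- sum⊆ p g sums g S over the lists S of the length of p with S ≤ p pointwise.
  sum⊆ : List Bool → (List Bool → ℤ) → ℤ
  sum⊆ []          g = g []
  sum⊆ (false ∷ p) g = sum⊆ p (λ S → g (false ∷ S))
  sum⊆ (true ∷ p)  g = sum⊆ p (λ S → g (false ∷ S)) +ℤ sum⊆ p (λ S → g (true ∷ S))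

  sum⊆-cong : (p : List Bool) {g h : List Bool → ℤ} → (∀ S → length S ≡ length p → g S ≡ h S) → sum⊆ p g ≡ sum⊆ p h
  sum⊆-cong []          e = e [] refl
  sum⊆-cong (false ∷ p) e = sum⊆-cong p (λ S l → e (false ∷ S) (cong suc l))
  sum⊆-cong (true ∷ p)  e = cong₂ _+ℤ_ (sum⊆-cong p (λ S l → e (false ∷ S) (cong suc l)))
                                       (sum⊆-cong p (λ S l → e (true ∷ S) (cong suc l)))

  sum⊆-*ˡ : (p : List Bool) (c : ℤ) (g : List Bool → ℤ) → sum⊆ p (λ S → c *ℤ g S) ≡ c *ℤ sum⊆ p g
  sum⊆-*ˡ []          c g = refl
  sum⊆-*ˡ (false ∷ p) c g = sum⊆-*ˡ p c _
  sum⊆-*ˡ (true ∷ p)  c g = trans (cong₂ _+ℤ_ (sum⊆-*ˡ p c _) (sum⊆-*ˡ p c _)) (sym (ℤ.*-distribˡ-+ c _ _))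

  sum⊆-∷ʳ : (p : List Bool) (b : Bool) (g : List Bool → ℤ) →
    sum⊆ (p ++ b ∷ []) g ≡ sum⊆ p (λ S → g (S ++ false ∷ [])) +ℤ (if b then sum⊆ p (λ S → g (S ++ true ∷ [])) else + 0)
  sum⊆-∷ʳ []          false g = sym (ℤ.+-identityʳ _)
  sum⊆-∷ʳ []          true  g = refl
  sum⊆-∷ʳ (false ∷ p) b     g = sum⊆-∷ʳ p b (λ S → g (false ∷ S))
  sum⊆-∷ʳ (true ∷ p)  false g = begin
    sum⊆ (p ++ false ∷ []) (λ S → g (false ∷ S)) +ℤ sum⊆ (p ++ false ∷ []) (λ S → g (true ∷ S))
      ≡⟨ cong₂ _+ℤ_ (sum⊆-∷ʳ p false (λ S → g (false ∷ S))) (sum⊆-∷ʳ p false (λ S → g (true ∷ S))) ⟩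
    (sum⊆ p (λ S → g (false ∷ S ++ false ∷ [])) +ℤ + 0) +ℤ (sum⊆ p (λ S → g (true ∷ S ++ false ∷ [])) +ℤ + 0)
      ≡⟨ cong₂ _+ℤ_ (ℤ.+-identityʳ (sum⊆ p (λ S → g (false ∷ S ++ false ∷ []))))
                    (ℤ.+-identityʳ (sum⊆ p (λ S → g (true ∷ S ++ false ∷ [])))) ⟩
    sum⊆ p (λ S → g (false ∷ S ++ false ∷ [])) +ℤ sum⊆ p (λ S → g (true ∷ S ++ false ∷ []))
      ≡⟨ ℤ.+-identityʳ _ ⟨
    sum⊆ (true ∷ p) (λ S → g (S ++ false ∷ [])) +ℤ + 0 ∎
    where open ≡-Reasoning
  sum⊆-∷ʳ (true ∷ p)  true  g = trans
    (cong₂ _+ℤ_ (sum⊆-∷ʳ p true (λ S → g (false ∷ S))) (sum⊆-∷ʳ p true (λ S → g (true ∷ S))))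
    (interchange (sum⊆ p (λ S → g (false ∷ S ++ false ∷ []))) (sum⊆ p (λ S → g (true ∷ S ++ false ∷ [])))
                 (sum⊆ p (λ S → g (false ∷ S ++ true ∷ []))) (sum⊆ p (λ S → g (true ∷ S ++ true ∷ []))))
    where
    interchange : ∀ (a b c d : ℤ) → (a +ℤ c) +ℤ (b +ℤ d) ≡ (a +ℤ b) +ℤ (c +ℤ d)
    interchange = ℤ-Solver.solve-∀

  sum⊆-signed≡signedSum⊆ : ∀ {m} (J : Fin m → Bool) (g : List Bool → ℤ) →
    sum⊆ (tabulate J) (λ S → -ℤ (sgn (#true S) *ℤ g S)) ≡
    sgn (suc (#true (tabulate J))) *ℤ signedSum⊆ J (g ∘ tabulate)
  sum⊆-signed≡signedSum⊆ {zero}  J g = trans (cong -ℤ_ (ℤ.*-identityˡ (g []))) (sym (ℤ.-1*i≡-i (g [])))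
  sum⊆-signed≡signedSum⊆ {suc m} J g with J fzero
  ... | false = sum⊆-signed≡signedSum⊆ (J ∘ fsuc) (λ S → g (false ∷ S))
  ... | true  = begin
    sum⊆ (tabulate J′) (λ S → -ℤ (sgn (#true S) *ℤ g (false ∷ S))) +ℤ
    sum⊆ (tabulate J′) (λ S → -ℤ ((-ℤ (+ 1)) *ℤ sgn (#true S) *ℤ g (true ∷ S)))
      ≡⟨ cong (_+ℤ_ (sum⊆ (tabulate J′) (λ S → -ℤ (sgn (#true S) *ℤ g (false ∷ S)))))
              (sum⊆-cong (tabulate J′) (λ S _ → move-sign (sgn (#true S)) (g (true ∷ S)))) ⟩
    sum⊆ (tabulate J′) (λ S → -ℤ (sgn (#true S) *ℤ g (false ∷ S))) +ℤ
    sum⊆ (tabulate J′) (λ S → -ℤ (sgn (#true S) *ℤ (-ℤ g (true ∷ S))))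
      ≡⟨ cong₂ _+ℤ_ (sum⊆-signed≡signedSum⊆ J′ (λ S → g (false ∷ S)))
                    (trans (sum⊆-signed≡signedSum⊆ J′ (λ S → -ℤ g (true ∷ S)))
                           (cong (s *ℤ_) (signedSum⊆-neg J′ (λ S → g (true ∷ tabulate S))))) ⟩
    s *ℤ signedSum⊆ J′ (λ S → g (false ∷ tabulate S)) +ℤ s *ℤ (-ℤ signedSum⊆ J′ (λ S → g (true ∷ tabulate S)))
      ≡⟨ collect s (signedSum⊆ J′ (λ S → g (true ∷ tabulate S))) (signedSum⊆ J′ (λ S → g (false ∷ tabulate S))) ⟩
    (-ℤ s) *ℤ (signedSum⊆ J′ (λ S → g (true ∷ tabulate S)) -ℤ signedSum⊆ J′ (λ S → g (false ∷ tabulate S)))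
      ≡⟨ cong (_*ℤ (signedSum⊆ J′ (λ S → g (true ∷ tabulate S)) -ℤ signedSum⊆ J′ (λ S → g (false ∷ tabulate S))))
              (ℤ.-1*i≡-i s) ⟨
    sgn (suc (suc (#true (tabulate J′)))) *ℤ
      (signedSum⊆ J′ (λ S → g (true ∷ tabulate S)) -ℤ signedSum⊆ J′ (λ S → g (false ∷ tabulate S))) ∎
    where
    open ≡-Reasoning
    J′ = J ∘ fsuc
    s = sgn (suc (#true (tabulate J′)))
    move-sign : ∀ σ x → -ℤ ((-ℤ (+ 1)) *ℤ σ *ℤ x) ≡ -ℤ (σ *ℤ (-ℤ x))
    move-sign = ℤ-Solver.solve-∀
    collect : ∀ s a b → s *ℤ b +ℤ s *ℤ (-ℤ a) ≡ (-ℤ s) *ℤ (a -ℤ b)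
    collect = ℤ-Solver.solve-∀

  selectedRanks : (ℕ → Bool) → ℕ → List Bool
  selectedRanks sel zero    = []
  selectedRanks sel (suc q) = selectedRanks sel q ++ sel (suc q) ∷ []

  length-selectedRanks : ∀ sel q → length (selectedRanks sel q) ≡ q
  length-selectedRanks sel zero    = refl
  length-selectedRanks sel (suc q) =
    trans (length-++ (selectedRanks sel q)) (trans (cong (_+ 1) (length-selectedRanks sel q)) (+-comm q 1))

  selectedRanks≡tabulate : ∀ sel q → selectedRanks sel q ≡ tabulate (λ (i : Fin q) → sel (suc (toℕ i)))
  selectedRanks≡tabulate sel q = trans (as-applyUpTo q) (sym (tabulate-toℕ q (sel ∘ suc)))
    where
    as-applyUpTo : ∀ q → selectedRanks sel q ≡ applyUpTo (sel ∘ suc) q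
    as-applyUpTo zero    = refl
    as-applyUpTo (suc q) = trans (cong (_++ sel (suc q) ∷ []) (as-applyUpTo q)) (applyUpTo-∷ʳ (sel ∘ suc) q)
    tabulate-toℕ : ∀ q (h : ℕ → Bool) → tabulate (λ (i : Fin q) → h (toℕ i)) ≡ applyUpTo h q
    tabulate-toℕ zero    h = refl
    tabulate-toℕ (suc q) h = cong (h 0 ∷_) (tabulate-toℕ q (h ∘ suc))

  module _ (t : ℕ) (sel : ℕ → Bool) where

    -- Philip Hall's alternating sum over the sub-selections S ≤ p; the padding by k forced ascents
    -- is what makes the induction in chainSum-rec go through.
    chainSum : ℕ → List Bool → ℕ → ℤ
    chainSum r p k = sum⊆ p (λ S → -ℤ (sgn (#true S) *ℤ + (α r (S ++ ascending k) ^ t)))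

    -- μ(0̂, x) for x of rank r in the rank selection sel of the t-fold Segre power: mobiusOfRank-rec
    -- is the recursion defining μ, and SegreMobius.μ-bottom the identification.
    mobiusOfRank : ℕ → ℤ
    mobiusOfRank zero    = + 1
    mobiusOfRank (suc q) = chainSum (suc q) (selectedRanks sel q) 0

    mobiusTerm : ℕ → ℕ → ℤ
    mobiusTerm r s = if sel s then + (binom r s ^ t) *ℤ mobiusOfRank s else + 0

    chainSum-∷ʳ-false : ∀ q k r →
      sum⊆ (selectedRanks sel q) (λ S → -ℤ (sgn (#true (S ++ false ∷ [])) *ℤ + (α r ((S ++ false ∷ []) ++ ascending k) ^ t)))
      ≡ chainSum r (selectedRanks sel q) (suc k)
    chainSum-∷ʳ-false q k r = sum⊆-cong (selectedRanks sel q)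
      (λ S _ → cong₂ (λ n L → -ℤ (sgn n *ℤ + (α r L ^ t))) (#true-∷ʳ S false) (++-assoc S (false ∷ []) (ascending k)))

    chainSum-∷ʳ-true : ∀ q k r → r ≡ suc q + suc k →
      sum⊆ (selectedRanks sel q) (λ S → -ℤ (sgn (#true (S ++ true ∷ [])) *ℤ + (α r ((S ++ true ∷ []) ++ ascending k) ^ t)))
      ≡ (-ℤ + (binom r (suc q) ^ t)) *ℤ mobiusOfRank (suc q)
    chainSum-∷ʳ-true q k r r≡ = trans (sum⊆-cong (selectedRanks sel q) term) (sum⊆-*ˡ (selectedRanks sel q) (-ℤ + (c ^ t)) _)
      where
      c = binom r (suc q)
      term : ∀ S → length S ≡ length (selectedRanks sel q) →
        -ℤ (sgn (#true (S ++ true ∷ [])) *ℤ + (α r ((S ++ true ∷ []) ++ ascending k) ^ t))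
        ≡ (-ℤ + (c ^ t)) *ℤ (-ℤ (sgn (#true S) *ℤ + (α (suc q) (S ++ ascending 0) ^ t)))
      term S |S|≡ = begin
        -ℤ (sgn (#true (S ++ true ∷ [])) *ℤ + (α r ((S ++ true ∷ []) ++ ascending k) ^ t))
          ≡⟨ cong₂ (λ n L → -ℤ (sgn n *ℤ + (α r L ^ t))) (#true-∷ʳ S true) (++-assoc S (true ∷ []) (ascending k)) ⟩
        -ℤ (sgn (suc (#true S)) *ℤ + (α r (S ++ true ∷ ascending k) ^ t))
          ≡⟨ cong (λ z → -ℤ (sgn (suc (#true S)) *ℤ + (z ^ t)))
                  (α-++-ascending S k r (trans r≡ (cong (λ z → suc z + suc k) (sym |S|≡q)))) ⟩
        -ℤ (sgn (suc (#true S)) *ℤ + ((binom r (suc (length S)) * α (suc (length S)) S) ^ t))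
          ≡⟨ cong (λ z → -ℤ (sgn (suc (#true S)) *ℤ + ((binom r (suc z) * α (suc z) S) ^ t))) |S|≡q ⟩
        -ℤ (sgn (suc (#true S)) *ℤ + ((c * α (suc q) S) ^ t))
          ≡⟨ cong (λ z → -ℤ (sgn (suc (#true S)) *ℤ + z)) (^-distribʳ-* c (α (suc q) S) t) ⟩
        -ℤ (sgn (suc (#true S)) *ℤ + (c ^ t * α (suc q) S ^ t))
          ≡⟨ cong₂ (λ x y → -ℤ (x *ℤ y)) (ℤ.-1*i≡-i (sgn (#true S))) (ℤ.pos-* (c ^ t) (α (suc q) S ^ t)) ⟩
        -ℤ ((-ℤ sgn (#true S)) *ℤ (+ (c ^ t) *ℤ + (α (suc q) S ^ t)))
          ≡⟨ move-sign (sgn (#true S)) (+ (c ^ t)) (+ (α (suc q) S ^ t)) ⟩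
        (-ℤ + (c ^ t)) *ℤ (-ℤ (sgn (#true S) *ℤ + (α (suc q) S ^ t)))
          ≡⟨ cong (λ L → (-ℤ + (c ^ t)) *ℤ (-ℤ (sgn (#true S) *ℤ + (α (suc q) L ^ t)))) (++-identityʳ S) ⟨
        (-ℤ + (c ^ t)) *ℤ (-ℤ (sgn (#true S) *ℤ + (α (suc q) (S ++ ascending 0) ^ t))) ∎
        where
        open ≡-Reasoning
        |S|≡q : length S ≡ q
        |S|≡q = trans |S|≡ (length-selectedRanks sel q)
        move-sign : ∀ σ b a → -ℤ ((-ℤ σ) *ℤ (b *ℤ a)) ≡ (-ℤ b) *ℤ (-ℤ (σ *ℤ a))
        move-sign = ℤ-Solver.solve-∀

    chainSum-rec : sel 0 ≡ true → ∀ q k →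
      chainSum (suc (q + k)) (selectedRanks sel q) k ≡ -ℤ sumBelowℤ (suc q) (mobiusTerm (suc (q + k)))
    chainSum-rec sel0 zero k rewrite sel0 = begin
      -ℤ (+ 1 *ℤ + (α (suc k) (ascending k) ^ t))  ≡⟨ cong (λ z → -ℤ (+ 1 *ℤ + (z ^ t))) (α-ascending-diag k) ⟩
      -ℤ (+ 1 *ℤ + (1 ^ t))                         ≡⟨ cong (λ z → -ℤ (+ 1 *ℤ + z)) (^-zeroˡ t) ⟩
      -ℤ (+ 1)                                      ≡⟨ cong (λ z → -ℤ (+ z *ℤ + 1 +ℤ + 0)) (^-zeroˡ t) ⟨
      -ℤ (+ (1 ^ t) *ℤ + 1 +ℤ + 0)                  ∎
      where open ≡-Reasoning
    chainSum-rec sel0 (suc q) k = begin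
      chainSum r (selectedRanks sel q ++ sel (suc q) ∷ []) k
        ≡⟨ sum⊆-∷ʳ (selectedRanks sel q) (sel (suc q)) _ ⟩
      sum⊆ (selectedRanks sel q) (λ S → G (S ++ false ∷ [])) +ℤ
        (if sel (suc q) then sum⊆ (selectedRanks sel q) (λ S → G (S ++ true ∷ [])) else + 0)
        ≡⟨ cong₂ (λ x y → x +ℤ (if sel (suc q) then y else + 0)) last-false (chainSum-∷ʳ-true q k r (cong suc (sym (+-suc q k)))) ⟩
      -ℤ sumBelowℤ (suc q) (mobiusTerm r) +ℤ (if sel (suc q) then (-ℤ + (binom r (suc q) ^ t)) *ℤ mobiusOfRank (suc q) else + 0)
        ≡⟨ add-last (sel (suc q)) ⟩
      -ℤ (sumBelowℤ (suc q) (mobiusTerm r) +ℤ mobiusTerm r (suc q))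
        ≡⟨ cong -ℤ_ (sumBelowℤ-suc (suc q) (mobiusTerm r)) ⟨
      -ℤ sumBelowℤ (suc (suc q)) (mobiusTerm r) ∎
      where
      open ≡-Reasoning
      r = suc (suc q + k)
      G : List Bool → ℤ
      G S = -ℤ (sgn (#true S) *ℤ + (α r (S ++ ascending k) ^ t))
      last-false : sum⊆ (selectedRanks sel q) (λ S → G (S ++ false ∷ [])) ≡ -ℤ sumBelowℤ (suc q) (mobiusTerm r)
      last-false = trans (chainSum-∷ʳ-false q k r)
        (subst (λ r′ → chainSum r′ (selectedRanks sel q) (suc k) ≡ -ℤ sumBelowℤ (suc q) (mobiusTerm r′))
               (cong suc (+-suc q k)) (chainSum-rec sel0 q (suc k)))
      add-last : ∀ b → -ℤ sumBelowℤ (suc q) (mobiusTerm r) +ℤ (if b then (-ℤ + (binom r (suc q) ^ t)) *ℤ mobiusOfRank (suc q) else + 0)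
                     ≡ -ℤ (sumBelowℤ (suc q) (mobiusTerm r) +ℤ (if b then + (binom r (suc q) ^ t) *ℤ mobiusOfRank (suc q) else + 0))
      add-last true  = neg-distrib (sumBelowℤ (suc q) (mobiusTerm r)) (+ (binom r (suc q) ^ t)) (mobiusOfRank (suc q))
        where
        neg-distrib : ∀ x y z → -ℤ x +ℤ (-ℤ y) *ℤ z ≡ -ℤ (x +ℤ y *ℤ z)
        neg-distrib = ℤ-Solver.solve-∀
      add-last false = neg-distrib (sumBelowℤ (suc q) (mobiusTerm r))
        where
        neg-distrib : ∀ x → -ℤ x +ℤ + 0 ≡ -ℤ (x +ℤ + 0)
        neg-distrib = ℤ-Solver.solve-∀

    mobiusOfRank-rec : sel 0 ≡ true → ∀ q → mobiusOfRank (suc q) ≡ -ℤ sumBelowℤ (suc q) (mobiusTerm (suc q))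
    mobiusOfRank-rec sel0 q =
      subst (λ z → chainSum (suc z) (selectedRanks sel q) 0 ≡ -ℤ sumBelowℤ (suc q) (mobiusTerm (suc z)))
            (+-identityʳ q) (chainSum-rec sel0 q 0)

  -- The Boolean lattice and its Segre powers

  empty-⊆ᵇ : ∀ {n} (A : Subset n) → ⊆ᵇ (Vec.replicate n false) A ≡ true
  empty-⊆ᵇ []      = refl
  empty-⊆ᵇ (a ∷ A) = empty-⊆ᵇ A

  ⊆ᵇ-full : ∀ {n} (A : Subset n) → ⊆ᵇ A (Vec.replicate n true) ≡ true
  ⊆ᵇ-full []      = refl
  ⊆ᵇ-full (a ∷ A) = trans (cong (_∧ ⊆ᵇ A _) (∨-zeroʳ (not a))) (⊆ᵇ-full A)

  empty-≡ᵇ-sub : ∀ {n} (A : Subset n) → ≡ᵇ-sub (Vec.replicate n false) A ≡ (∣ A ∣ ≡ᵇ 0)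
  empty-≡ᵇ-sub []          = refl
  empty-≡ᵇ-sub (true ∷ A)  = refl
  empty-≡ᵇ-sub (false ∷ A) = empty-≡ᵇ-sub A

  ⊆ᵇ⇒∣∣≤ : ∀ {n} (A B : Subset n) → ⊆ᵇ A B ≡ true → ∣ A ∣ ≤ ∣ B ∣
  ⊆ᵇ⇒∣∣≤ []          []          _   = z≤n
  ⊆ᵇ⇒∣∣≤ (true ∷ A)  (true ∷ B)  A⊆B = s≤s (⊆ᵇ⇒∣∣≤ A B A⊆B)
  ⊆ᵇ⇒∣∣≤ (false ∷ A) (true ∷ B)  A⊆B = m≤n⇒m≤1+n (⊆ᵇ⇒∣∣≤ A B A⊆B)
  ⊆ᵇ⇒∣∣≤ (false ∷ A) (false ∷ B) A⊆B = ⊆ᵇ⇒∣∣≤ A B A⊆B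

  ⊆ᵇ∧∣∣≡⇒≡ᵇ-sub : ∀ {n} (A B : Subset n) → ⊆ᵇ A B ≡ true → ∣ A ∣ ≡ ∣ B ∣ → ≡ᵇ-sub A B ≡ true
  ⊆ᵇ∧∣∣≡⇒≡ᵇ-sub []          []          _   _    = refl
  ⊆ᵇ∧∣∣≡⇒≡ᵇ-sub (true ∷ A)  (true ∷ B)  A⊆B |A|≡ = ⊆ᵇ∧∣∣≡⇒≡ᵇ-sub A B A⊆B (suc-injective |A|≡)
  ⊆ᵇ∧∣∣≡⇒≡ᵇ-sub (false ∷ A) (true ∷ B)  A⊆B |A|≡ = ⊥-elim (n≮n ∣ B ∣ (subst (_≤ ∣ B ∣) |A|≡ (⊆ᵇ⇒∣∣≤ A B A⊆B)))
  ⊆ᵇ∧∣∣≡⇒≡ᵇ-sub (false ∷ A) (false ∷ B) A⊆B |A|≡ = ⊆ᵇ∧∣∣≡⇒≡ᵇ-sub A B A⊆B |A|≡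

  ≡ᵇ-sub⇒∣∣≡ : ∀ {n} (A B : Subset n) → ≡ᵇ-sub A B ≡ true → ∣ A ∣ ≡ ∣ B ∣
  ≡ᵇ-sub⇒∣∣≡ []          []          _    = refl
  ≡ᵇ-sub⇒∣∣≡ (true ∷ A)  (true ∷ B)  A≡B = cong suc (≡ᵇ-sub⇒∣∣≡ A B A≡B)
  ≡ᵇ-sub⇒∣∣≡ (false ∷ A) (false ∷ B) A≡B = ≡ᵇ-sub⇒∣∣≡ A B A≡B

  count-subsets-of-size : ∀ n (B : Subset n) s → countᵇ (λ A → (∣ A ∣ ≡ᵇ s) ∧ ⊆ᵇ A B) (allSubsets n) ≡ binom ∣ B ∣ s
  count-subsets-of-size zero    [] zero    = refl
  count-subsets-of-size zero    [] (suc s) = refl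
  count-subsets-of-size (suc n) (b ∷ B) s = begin
    countᵇ P (map (true ∷_) V ++ map (false ∷_) V ++ [])
      ≡⟨ countᵇ-++ P (map (true ∷_) V) (map (false ∷_) V ++ []) ⟩
    countᵇ P (map (true ∷_) V) + countᵇ P (map (false ∷_) V ++ [])
      ≡⟨ cong₂ _+_ (countᵇ-map P (true ∷_) V) (trans (cong (countᵇ P) (++-identityʳ (map (false ∷_) V))) (countᵇ-map P (false ∷_) V)) ⟩
    countᵇ (P ∘ (true ∷_)) V + countᵇ (P ∘ (false ∷_)) V
      ≡⟨ by-first-element b s ⟩
    binom ∣ b ∷ B ∣ s ∎
    where
    open ≡-Reasoning
    V = allSubsets n
    P : Subset (suc n) → Bool
    P A = (∣ A ∣ ≡ᵇ s) ∧ ⊆ᵇ A (b ∷ B)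
    by-first-element : ∀ b s →
      countᵇ (λ A → (∣ true ∷ A ∣ ≡ᵇ s) ∧ ⊆ᵇ (true ∷ A) (b ∷ B)) V +
      countᵇ (λ A → (∣ false ∷ A ∣ ≡ᵇ s) ∧ ⊆ᵇ (false ∷ A) (b ∷ B)) V ≡ binom ∣ b ∷ B ∣ s
    by-first-element true  zero    = cong₂ _+_ (countᵇ-false V) (count-subsets-of-size n B zero)
    by-first-element true  (suc s) = cong₂ _+_ (count-subsets-of-size n B s) (count-subsets-of-size n B (suc s))
    by-first-element false s       = cong₂ _+_ (trans (countᵇ-cong _ _ V (λ {A} _ → ∧-zeroʳ (∣ true ∷ A ∣ ≡ᵇ s)))
                                                      (countᵇ-false V))
                                               (count-subsets-of-size n B s)

  hasRank : ∀ {t n} → ℕ → Tuple t n → Bool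
  hasRank r z = allᵥ (λ A → ∣ A ∣ ≡ᵇ r) z

  bottom-≤ : ∀ {t n} (z : Tuple t n) → leqTuple (bottomT t n) z ≡ true
  bottom-≤ []      = refl
  bottom-≤ {suc t} {n} (A ∷ z) = trans (cong (_∧ leqTuple (bottomT t n) z) (empty-⊆ᵇ A)) (bottom-≤ z)

  ≤-top : ∀ {t n} (z : Tuple t n) → leqTuple z (topT t n) ≡ true
  ≤-top []      = refl
  ≤-top {suc t} {n} (A ∷ z) = trans (cong (_∧ leqTuple z (topT t n)) (⊆ᵇ-full A)) (≤-top z)

  hasRank-top : ∀ t n → hasRank n (topT t n) ≡ true
  hasRank-top zero    n = refl
  hasRank-top (suc t) n =
    trans (cong (λ z → (z ≡ᵇ n) ∧ hasRank n (topT t n)) (∣⊤∣≡n n))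
          (trans (cong (_∧ hasRank n (topT t n)) (≡ᵇ-refl n)) (hasRank-top t n))

  bottom-≡ : ∀ {t n} (z : Tuple t n) → eqTuple (bottomT t n) z ≡ hasRank 0 z
  bottom-≡ []      = refl
  bottom-≡ (A ∷ z) = cong₂ _∧_ (empty-≡ᵇ-sub A) (bottom-≡ z)

  hasRank-head : ∀ {t n r} (A : Subset n) (z : Tuple t n) → hasRank r (A ∷ z) ≡ true → ∣ A ∣ ≡ r
  hasRank-head A z rk = ≡ᵇ⇒≡′ (∧-true⁻ˡ _ _ rk)

  ≢-rank⇒≢ : ∀ {t n s r} (z x : Tuple (suc t) n) → hasRank s z ≡ true → hasRank r x ≡ true → s ≢ r → eqTuple z x ≡ false
  ≢-rank⇒≢ (A ∷ z) (B ∷ x) rk-z rk-x s≢r with ≡ᵇ-sub A B in A≡B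
  ... | false = refl
  ... | true  = ⊥-elim (s≢r (trans (sym (hasRank-head A z rk-z)) (trans (≡ᵇ-sub⇒∣∣≡ A B A≡B) (hasRank-head B x rk-x))))

  ≤⇒rank≤ : ∀ {t n s r} (z x : Tuple (suc t) n) → hasRank s z ≡ true → hasRank r x ≡ true → leqTuple z x ≡ true → s ≤ r
  ≤⇒rank≤ (A ∷ z) (B ∷ x) rk-z rk-x z≤x =
    subst₂ _≤_ (hasRank-head A z rk-z) (hasRank-head B x rk-x) (⊆ᵇ⇒∣∣≤ A B (∧-true⁻ˡ _ _ z≤x))

  ≤∧same-rank⇒≡ : ∀ {t n r} (z x : Tuple t n) → hasRank r z ≡ true → hasRank r x ≡ true → leqTuple z x ≡ true →
    eqTuple z x ≡ true
  ≤∧same-rank⇒≡ []      []      _    _    _   = refl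
  ≤∧same-rank⇒≡ (A ∷ z) (B ∷ x) rk-z rk-x z≤x = trans
    (cong (_∧ eqTuple z x) (⊆ᵇ∧∣∣≡⇒≡ᵇ-sub A B (∧-true⁻ˡ _ _ z≤x) (trans (hasRank-head A z rk-z) (sym (hasRank-head B x rk-x)))))
    (≤∧same-rank⇒≡ z x (∧-true⁻ʳ _ _ rk-z) (∧-true⁻ʳ _ _ rk-x) (∧-true⁻ʳ _ _ z≤x))

  count-below : ∀ t n r s (x : Tuple t n) → hasRank r x ≡ true →
    countᵇ (λ z → leqTuple z x) (tuplesOfRank t n s) ≡ binom r s ^ t
  count-below t n r s x rk-x = begin
    countᵇ (λ z → leqTuple z x) (filterᵇ (hasRank s) (allVecs (allSubsets n) t))
      ≡⟨ cong length (filterᵇ-filterᵇ (λ z → leqTuple z x) (hasRank s) (allVecs (allSubsets n) t)) ⟩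
    countᵇ (λ z → hasRank s z ∧ leqTuple z x) (allVecs (allSubsets n) t)
      ≡⟨ countᵇ-cong _ _ (allVecs (allSubsets n) t) (λ {z} _ → componentwise z x) ⟩
    countᵇ (allZipᵥ (subsetsOfSizeBelow x)) (allVecs (allSubsets n) t)
      ≡⟨ countᵇ-allVecs-allZipᵥ (allSubsets n) t (subsetsOfSizeBelow x) ⟩
    Vec.foldr (λ _ → ℕ) (λ q m → countᵇ q (allSubsets n) * m) 1 (subsetsOfSizeBelow x)
      ≡⟨ product x rk-x ⟩
    binom r s ^ t ∎
    where
    open ≡-Reasoning
    subsetsOfSizeBelow : ∀ {t} → Tuple t n → Vec (Subset n → Bool) t
    subsetsOfSizeBelow []      = []
    subsetsOfSizeBelow (B ∷ x) = (λ A → (∣ A ∣ ≡ᵇ s) ∧ ⊆ᵇ A B) ∷ subsetsOfSizeBelow x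
    componentwise : ∀ {t} (z x : Tuple t n) → (hasRank s z ∧ leqTuple z x) ≡ allZipᵥ (subsetsOfSizeBelow x) z
    componentwise []      []      = refl
    componentwise (A ∷ z) (B ∷ x) = trans (∧-interchange (∣ A ∣ ≡ᵇ s) (hasRank s z) (⊆ᵇ A B) (leqTuple z x))
                                          (cong (((∣ A ∣ ≡ᵇ s) ∧ ⊆ᵇ A B) ∧_) (componentwise z x))
    product : ∀ {t} (x : Tuple t n) → hasRank r x ≡ true →
      Vec.foldr (λ _ → ℕ) (λ q m → countᵇ q (allSubsets n) * m) 1 (subsetsOfSizeBelow x) ≡ binom r s ^ t
    product []      _    = refl
    product (B ∷ x) rk-x = cong₂ _*_ (trans (count-subsets-of-size n B s) (cong (λ z → binom z s) (hasRank-head B x rk-x)))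
                                     (product x (∧-true⁻ʳ _ _ rk-x))

  sumBelowℤ-truncate : ∀ r (h : ℕ → ℤ) N → r ≤ N → sumBelowℤ N (λ s → if s <ᵇ r then h s else + 0) ≡ sumBelowℤ r h
  sumBelowℤ-truncate r h N r≤N = begin
    sumBelowℤ N h<r             ≡⟨ cong (λ z → sumBelowℤ z h<r) (m+[n∸m]≡n r≤N) ⟨
    sumBelowℤ (r + (N ∸ r)) h<r ≡⟨ beyond-r (N ∸ r) ⟩
    sumBelowℤ r h<r             ≡⟨ below-r r ≤-refl ⟩
    sumBelowℤ r h               ∎
    where
    open ≡-Reasoning
    h<r = λ s → if s <ᵇ r then h s else + 0
    below-r : ∀ M → M ≤ r → sumBelowℤ M h<r ≡ sumBelowℤ M h
    below-r zero    _   = refl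
    below-r (suc M) M<r = begin
      sumBelowℤ (suc M) h<r           ≡⟨ sumBelowℤ-suc M h<r ⟩
      sumBelowℤ M h<r +ℤ h<r M        ≡⟨ cong₂ _+ℤ_ (below-r M (<⇒≤ M<r)) (cong (λ b → if b then h M else + 0) (<⇒<ᵇ≡true M<r)) ⟩
      sumBelowℤ M h +ℤ h M            ≡⟨ sumBelowℤ-suc M h ⟨
      sumBelowℤ (suc M) h             ∎
    beyond-r : ∀ d → sumBelowℤ (r + d) h<r ≡ sumBelowℤ r h<r
    beyond-r zero    = cong (λ z → sumBelowℤ z h<r) (+-identityʳ r)
    beyond-r (suc d) = begin
      sumBelowℤ (r + suc d) h<r             ≡⟨ cong (λ z → sumBelowℤ z h<r) (+-suc r d) ⟩
      sumBelowℤ (suc (r + d)) h<r           ≡⟨ sumBelowℤ-suc (r + d) h<r ⟩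
      sumBelowℤ (r + d) h<r +ℤ h<r (r + d)  ≡⟨ cong₂ _+ℤ_ (beyond-r d)
                                                  (cong (λ b → if b then h (r + d) else + 0) (≮⇒<ᵇ≡false (m+n≮m r d))) ⟩
      sumBelowℤ r h<r +ℤ + 0                ≡⟨ ℤ.+-identityʳ _ ⟩
      sumBelowℤ r h<r                       ∎

  module SegreMobius (t′ n : ℕ) (sel : ℕ → Bool) (sel0 : sel 0 ≡ true) where

    t : ℕ
    t = suc t′

    elements : List (Tuple t n)
    elements = segreElems t n sel

    μ : ℕ → Tuple t n → Tuple t n → ℤ
    μ = Möbius.mobiusAux elements leqTuple eqTuple

    ⊥ₜ : Tuple t n
    ⊥ₜ = bottomT t n

    -- Number of selected ranks below r: the recursion of μ(0̂, x), x of rank r, runs along chains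
    -- through selected ranks, so fuel exceeding it suffices.
    ρ : ℕ → ℕ
    ρ r = countᵇ sel (upTo r)

    ρ-suc : ∀ s → ρ (suc s) ≡ ρ s + (if sel s then 1 else 0)
    ρ-suc s = begin
      countᵇ sel (upTo (suc s))            ≡⟨ cong (countᵇ sel) (applyUpTo-∷ʳ (λ x → x) s) ⟨
      countᵇ sel (upTo s ++ s ∷ [])        ≡⟨ countᵇ-++ sel (upTo s) (s ∷ []) ⟩
      ρ s + countᵇ sel (s ∷ [])            ≡⟨ cong (_+_ (ρ s)) (countᵇ-∷ sel s []) ⟩
      ρ s + (if sel s then 1 else 0)       ∎
      where open ≡-Reasoning

    ρ-mono : ∀ a d → ρ a ≤ ρ (a + d)
    ρ-mono a zero    = ≤-reflexive (cong ρ (sym (+-identityʳ a)))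
    ρ-mono a (suc d) = ≤-trans (ρ-mono a d) (≤-trans (m≤m+n (ρ (a + d)) _)
                               (≤-reflexive (trans (sym (ρ-suc (a + d))) (cong ρ (sym (+-suc a d))))))

    ρ-<-selected : ∀ {s r} → sel s ≡ true → s < r → ρ s < ρ r
    ρ-<-selected {s} {r} sel-s s<r = begin-strict
      ρ s                       <⟨ n<1+n (ρ s) ⟩
      suc (ρ s)                 ≡⟨ trans (ρ-suc s) (trans (cong (λ b → ρ s + (if b then 1 else 0)) sel-s) (+-comm (ρ s) 1)) ⟨
      ρ (suc s)                 ≤⟨ ρ-mono (suc s) (r ∸ suc s) ⟩
      ρ (suc s + (r ∸ suc s))   ≡⟨ cong ρ (m+[n∸m]≡n s<r) ⟩
      ρ r                       ∎
      where open ≤-Reasoning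

    layer : ℕ → List (Tuple t n)
    layer s = if sel s then tuplesOfRank t n s else []

    strictlyBelow : Tuple t n → Tuple t n → Bool
    strictlyBelow x z = leqTuple ⊥ₜ z ∧ leqTuple z x ∧ not (eqTuple z x)

    ∈-tuplesOfRank⁻ : ∀ {s z} → z ∈ tuplesOfRank t n s → hasRank s z ≡ true
    ∈-tuplesOfRank⁻ {s} z∈ = proj₂ (∈-filterᵇ⁻ (hasRank s) {allVecs (allSubsets n) t} z∈)

    strictlyBelow-lower-rank : ∀ {s r} (x : Tuple t n) → hasRank r x ≡ true → s < r →
      ∀ {z} → z ∈ tuplesOfRank t n s → strictlyBelow x z ≡ leqTuple z x
    strictlyBelow-lower-rank x rk-x s<r {z} z∈ = begin
      leqTuple ⊥ₜ z ∧ leqTuple z x ∧ not (eqTuple z x)  ≡⟨ cong (λ b → b ∧ leqTuple z x ∧ not (eqTuple z x)) (bottom-≤ z) ⟩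
      leqTuple z x ∧ not (eqTuple z x)                  ≡⟨ cong (λ b → leqTuple z x ∧ not b)
                                                               (≢-rank⇒≢ z x (∈-tuplesOfRank⁻ z∈) rk-x (<⇒≢ s<r)) ⟩
      leqTuple z x ∧ true                               ≡⟨ ∧-identityʳ _ ⟩
      leqTuple z x                                      ∎
      where open ≡-Reasoning

    strictlyBelow-other-rank : ∀ {s r} (x : Tuple t n) → hasRank r x ≡ true → ¬ s < r →
      ∀ {z} → z ∈ tuplesOfRank t n s → strictlyBelow x z ≡ false
    strictlyBelow-other-rank {s} {r} x rk-x s≮r {z} z∈ with leqTuple z x in z≤x
    ... | false = ∧-zeroʳ _
    ... | true  = trans (cong (λ b → b ∧ true ∧ not (eqTuple z x)) (bottom-≤ z))
                        (cong not (≤∧same-rank⇒≡ z x (subst (λ u → hasRank u z ≡ true) s≡r (∈-tuplesOfRank⁻ z∈)) rk-x z≤x))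
      where
      s≡r : s ≡ r
      s≡r = ≤-antisym (≤⇒rank≤ z x (∈-tuplesOfRank⁻ z∈) rk-x z≤x) (≮⇒≥ s≮r)

    layer-sum : ∀ k r (x : Tuple t n) → hasRank r x ≡ true → r ≤ n → ρ r < suc k →
      (∀ s (z : Tuple t n) → hasRank s z ≡ true → s ≤ n → ρ s < k → μ k ⊥ₜ z ≡ mobiusOfRank t sel s) →
      ∀ s → sumℤ (map (μ k ⊥ₜ) (filterᵇ (strictlyBelow x) (layer s))) ≡
            (if s <ᵇ r then mobiusTerm t sel r s else + 0)
    layer-sum k r x rk-x r≤n ρr<1+k μ-layer s with sel s in sel-s
    ... | false = sym (if-const (s <ᵇ r))
      where
      if-const : ∀ b → (if b then + 0 else + 0) ≡ + 0
      if-const true  = refl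
      if-const false = refl
    ... | true with s <? r
    ...   | yes s<r = begin
      sumℤ (map (μ k ⊥ₜ) (filterᵇ (strictlyBelow x) (tuplesOfRank t n s)))
        ≡⟨ sumℤ-map-const (μ k ⊥ₜ) (mobiusOfRank t sel s) _
             (λ z∈ → μ-layer s _ (∈-tuplesOfRank⁻ (proj₁ (∈-filterᵇ⁻ (strictlyBelow x) z∈))) (≤-trans (<⇒≤ s<r) r≤n)
                               (≤-trans (ρ-<-selected sel-s s<r) (≤-pred ρr<1+k))) ⟩
      + countᵇ (strictlyBelow x) (tuplesOfRank t n s) *ℤ mobiusOfRank t sel s
        ≡⟨ cong (λ c → + c *ℤ mobiusOfRank t sel s)
                (trans (countᵇ-cong _ _ (tuplesOfRank t n s) (strictlyBelow-lower-rank x rk-x s<r))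
                       (count-below t n r s x rk-x)) ⟩
      + (binom r s ^ t) *ℤ mobiusOfRank t sel s
        ≡⟨ cong (λ b → if b then + (binom r s ^ t) *ℤ mobiusOfRank t sel s else + 0) (<⇒<ᵇ≡true s<r) ⟨
      (if s <ᵇ r then + (binom r s ^ t) *ℤ mobiusOfRank t sel s else + 0) ∎
      where open ≡-Reasoning
    ...   | no s≮r = begin
      sumℤ (map (μ k ⊥ₜ) (filterᵇ (strictlyBelow x) (tuplesOfRank t n s)))
        ≡⟨ cong (sumℤ ∘ map (μ k ⊥ₜ)) (filterᵇ-none (strictlyBelow x) _ (strictlyBelow-other-rank x rk-x s≮r)) ⟩
      + 0
        ≡⟨ cong (λ b → if b then + (binom r s ^ t) *ℤ mobiusOfRank t sel s else + 0) (≮⇒<ᵇ≡false s≮r) ⟨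
      (if s <ᵇ r then + (binom r s ^ t) *ℤ mobiusOfRank t sel s else + 0) ∎
      where open ≡-Reasoning

    μ-bottom : ∀ k r (x : Tuple t n) → hasRank r x ≡ true → r ≤ n → ρ r < k → μ k ⊥ₜ x ≡ mobiusOfRank t sel r
    μ-bottom (suc k) zero    x rk-x _ _ rewrite bottom-≡ x | rk-x = refl
    μ-bottom (suc k) (suc q) x@(B ∷ _) rk-x r≤n ρr<1+k
      rewrite bottom-≡ x | hasRank-head B (Vec.tail x) rk-x | bottom-≤ x = begin
      -ℤ sumℤ (map (μ k ⊥ₜ) (filterᵇ (strictlyBelow x) (concatMap layer (upTo (suc n)))))
        ≡⟨ cong (λ l → -ℤ sumℤ (map (μ k ⊥ₜ) l)) (filterᵇ-concatMap (strictlyBelow x) layer (upTo (suc n))) ⟩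
      -ℤ sumℤ (map (μ k ⊥ₜ) (concatMap (filterᵇ (strictlyBelow x) ∘ layer) (upTo (suc n))))
        ≡⟨ cong -ℤ_ (sumℤ-map-concatMap (μ k ⊥ₜ) (filterᵇ (strictlyBelow x) ∘ layer) (upTo (suc n))) ⟩
      -ℤ sumBelowℤ (suc n) (λ s → sumℤ (map (μ k ⊥ₜ) (filterᵇ (strictlyBelow x) (layer s))))
        ≡⟨ cong -ℤ_ (sumℤ-map-cong _ _ (upTo (suc n))
                       (λ {s} _ → layer-sum k (suc q) x rk-x r≤n ρr<1+k (μ-bottom k) s)) ⟩
      -ℤ sumBelowℤ (suc n) (λ s → if s <ᵇ suc q then mobiusTerm t sel (suc q) s else + 0)
        ≡⟨ cong -ℤ_ (sumBelowℤ-truncate (suc q) (mobiusTerm t sel (suc q)) (suc n) (m≤n⇒m≤1+n r≤n)) ⟩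
      -ℤ sumBelowℤ (suc q) (mobiusTerm t sel (suc q))
        ≡⟨ mobiusOfRank-rec t sel sel0 q ⟨
      mobiusOfRank t sel (suc q) ∎
      where open ≡-Reasoning

    enough-fuel : sel n ≡ true → ρ n < length elements
    enough-fuel sel-n = begin-strict
      ρ n                                                   <⟨ ρ-<-selected sel-n (n<1+n n) ⟩
      ρ (suc n)                                             ≤⟨ countᵇ≤sum (upTo (suc n)) layer-nonempty ⟩
      sum (map (λ s → countᵇ (λ _ → true) (layer s)) (upTo (suc n)))
                                                            ≡⟨ countᵇ-concatMap (λ _ → true) layer (upTo (suc n)) ⟨
      countᵇ (λ _ → true) elements                          ≡⟨ countᵇ-true elements ⟩
      length elements                                       ∎
      where
      open ≤-Reasoning
      countᵇ≤sum : (L : List ℕ) {h : ℕ → ℕ} → (∀ {s} → s ∈ L → sel s ≡ true → 1 ≤ h s) → countᵇ sel L ≤ sum (map h L)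
      countᵇ≤sum []      _ = z≤n
      countᵇ≤sum (s ∷ L) {h} H with sel s in sel-s
      ... | true  = +-mono-≤ (H (here refl) sel-s) (countᵇ≤sum L (H ∘ there))
      ... | false = ≤-trans (countᵇ≤sum L (H ∘ there)) (m≤n+m _ (h s))
      layer-nonempty : ∀ {s} → s ∈ upTo (suc n) → sel s ≡ true → 1 ≤ countᵇ (λ _ → true) (layer s)
      layer-nonempty {s} s∈ sel-s rewrite sel-s = subst (1 ≤_)
        (sym (trans (countᵇ-cong _ _ (tuplesOfRank t n s) (λ {z} _ → sym (≤-top z))) (count-below t n n s (topT t n) (hasRank-top t n))))
        (^-positive t (binom-pos (≤-pred (∈-upTo⁻ s∈))))
        where
        ^-positive : ∀ {a} e → 1 ≤ a → 1 ≤ a ^ e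
        ^-positive zero    _   = ≤-refl
        ^-positive (suc e) 1≤a = *-mono-≤ 1≤a (^-positive e 1≤a)

    mobius-top : sel n ≡ true → Möbius.mobius elements leqTuple eqTuple ⊥ₜ (topT t n) ≡ mobiusOfRank t sel n
    mobius-top sel-n = μ-bottom (length elements) n (topT t n) (hasRank-top t n) ≤-refl (enough-fuel sel-n)

  mobius-rank-selection : ∀ t′ m (sel : ℕ → Bool) → sel 0 ≡ true → sel (suc m) ≡ true →
    (J : Fin m → Bool) → (∀ j → sel (suc (toℕ j)) ≡ J j) →
    Möbius.mobius (segreElems (suc t′) (suc m) sel) leqTuple eqTuple (bottomT (suc t′) (suc m)) (topT (suc t′) (suc m))
    ≡ sgn (suc (#true (tabulate J))) *ℤ signedSum⊆ J (λ S → + (α (suc m) (tabulate S) ^ suc t′))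
  mobius-rank-selection t′ m sel sel0 sel-top J sel≡J = begin
    Möbius.mobius (segreElems (suc t′) (suc m) sel) leqTuple eqTuple (bottomT (suc t′) (suc m)) (topT (suc t′) (suc m))
      ≡⟨ SegreMobius.mobius-top t′ (suc m) sel sel0 sel-top ⟩
    chainSum (suc t′) sel (suc m) (selectedRanks sel m) 0
      ≡⟨ cong (λ p → chainSum (suc t′) sel (suc m) p 0) (trans (selectedRanks≡tabulate sel m) (tabulate-cong sel≡J)) ⟩
    chainSum (suc t′) sel (suc m) (tabulate J) 0
      ≡⟨ sum⊆-cong (tabulate J) (λ S _ → cong (λ L → -ℤ (sgn (#true S) *ℤ + (α (suc m) L ^ suc t′))) (++-identityʳ S)) ⟩
    sum⊆ (tabulate J) (λ S → -ℤ (sgn (#true S) *ℤ + (α (suc m) S ^ suc t′)))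
      ≡⟨ sum⊆-signed≡signedSum⊆ J (λ S → + (α (suc m) S ^ suc t′)) ⟩
    sgn (suc (#true (tabulate J))) *ℤ signedSum⊆ J (λ S → + (α (suc m) (tabulate S) ^ suc t′)) ∎
    where open ≡-Reasoning

  anyᶠ : {m : ℕ} → (Fin m → Bool) → Bool
  anyᶠ {zero}  g = false
  anyᶠ {suc m} g = g fzero ∨ anyᶠ (g ∘ fsuc)

  anyᵥ-tabulate : {m : ℕ} (p : A → Bool) (f : Fin m → A) → anyᵥ p (Vec.tabulate f) ≡ anyᶠ (p ∘ f)
  anyᵥ-tabulate {m = zero}  p f = refl
  anyᵥ-tabulate {m = suc m} p f = cong (p (f fzero) ∨_) (anyᵥ-tabulate p (f ∘ fsuc))

  inJ-suc : ∀ {m} (J : Subset m) (j : Fin m) → inJ J (suc (toℕ j)) ≡ lookup J j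
  inJ-suc J j = trans (anyᵥ-tabulate (λ i → (toℕ i + 1 ≡ᵇ suc (toℕ j)) ∧ lookup J i) (λ i → i)) (at-index (lookup J) j)
    where
    none : {m : ℕ} (g : Fin m → Bool) → (∀ i → g i ≡ false) → anyᶠ g ≡ false
    none {zero}  g h = refl
    none {suc m} g h = cong₂ _∨_ (h fzero) (none (g ∘ fsuc) (h ∘ fsuc))
    at-index : ∀ {m} (P : Fin m → Bool) (j : Fin m) → anyᶠ (λ i → (toℕ i + 1 ≡ᵇ suc (toℕ j)) ∧ P i) ≡ P j
    at-index P fzero    = trans (cong (P fzero ∨_) (none _ (λ i → cong (λ z → (z ≡ᵇ 0) ∧ P (fsuc i)) (+-comm (toℕ i) 1))))
                                (∨-identityʳ (P fzero))
    at-index P (fsuc j) = at-index (P ∘ fsuc) j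

  ∣∣≡#true : ∀ {m} (J : Subset m) → ∣ J ∣ ≡ #true (tabulate (lookup J))
  ∣∣≡#true []          = refl
  ∣∣≡#true (true ∷ J)  = cong suc (∣∣≡#true J)
  ∣∣≡#true (false ∷ J) = ∣∣≡#true J

  #true-full : ∀ m → #true (tabulate (λ (_ : Fin m) → true)) ≡ m
  #true-full zero    = refl
  #true-full (suc m) = cong suc (#true-full m)

  mobiusSegreRankSel-formula : ∀ t′ m (J : Subset m) → mobiusSegreRankSel (suc t′) m J ≡ sgn (suc ∣ J ∣) *ℤ + wJ (suc t′) m J
  mobiusSegreRankSel-formula t′ m J = trans (mobius-rank-selection t′ m sel refl sel-top (lookup J) sel≡J)
    (cong₂ (λ a b → sgn (suc a) *ℤ b) (sym (∣∣≡#true J)) (sym (wJ≡signedSum⊆ (suc t′) m J)))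
    where
    sel : ℕ → Bool
    sel r = (r ≡ᵇ 0) ∨ (r ≡ᵇ suc m) ∨ inJ J r
    sel-top : sel (suc m) ≡ true
    sel-top rewrite ≡ᵇ-refl m = refl
    sel≡J : ∀ j → sel (suc (toℕ j)) ≡ lookup J j
    sel≡J j rewrite ≢⇒≡ᵇ≡false (<⇒≢ (s≤s (toℕ<n j))) = inJ-suc J j

  mobiusSegre-formula : ∀ t′ m → mobiusSegre (suc t′) (suc m) ≡ sgn (suc m) *ℤ + w (suc t′) (suc m)
  mobiusSegre-formula t′ m = trans (mobius-rank-selection t′ m (λ _ → true) refl refl (λ _ → true) (λ _ → refl))
    (cong₂ (λ a b → sgn (suc a) *ℤ b) (#true-full m) (sym (w≡signedSum⊆ (suc t′) m)))

  w-recurrence : ∀ t′ m → sumℤTo (suc m) (λ i → sgn i *ℤ + w (suc t′) i *ℤ + ((suc m C i) ^ suc t′)) ≡ + 0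
  w-recurrence t′ m = begin
    sumBelowℤ (suc n) (λ i → sgn i *ℤ + w t i *ℤ + ((n C i) ^ t))
      ≡⟨ sumℤ-map-cong _ _ (upTo (suc n)) (λ {i} _ → cong₂ _*ℤ_ (signed-w i) (cong (λ z → + (z ^ t)) (C≡binom n i))) ⟩
    sumBelowℤ (suc n) g
      ≡⟨ sumBelowℤ-suc n g ⟩
    sumBelowℤ n g +ℤ g n
      ≡⟨ cong₂ _+ℤ_ (sumℤ-map-cong g (mobiusTerm t full n) (upTo n) (λ {i} _ → ℤ.*-comm (μᵢ i) (+ (binom n i ^ t))))
                    (cong (λ z → μᵢ n *ℤ + z) (trans (cong (_^ t) (binom-diag n)) (^-zeroˡ t))) ⟩
    sumBelowℤ n (mobiusTerm t full n) +ℤ μᵢ n *ℤ + 1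
      ≡⟨ cong (λ z → sumBelowℤ n (mobiusTerm t full n) +ℤ z *ℤ + 1) (mobiusOfRank-rec t full refl m) ⟩
    sumBelowℤ n (mobiusTerm t full n) +ℤ (-ℤ sumBelowℤ n (mobiusTerm t full n)) *ℤ + 1
      ≡⟨ cancel (sumBelowℤ n (mobiusTerm t full n)) ⟩
    + 0 ∎
    where
    open ≡-Reasoning
    t = suc t′
    n = suc m
    full : ℕ → Bool
    full _ = true
    μᵢ : ℕ → ℤ
    μᵢ = mobiusOfRank t full
    g : ℕ → ℤ
    g i = μᵢ i *ℤ + (binom n i ^ t)
    signed-w : ∀ i → sgn i *ℤ + w t i ≡ μᵢ i
    signed-w zero    = refl
    signed-w (suc j) = trans (sym (mobiusSegre-formula t′ j)) (SegreMobius.mobius-top t′ (suc j) full refl refl)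
    cancel : ∀ x → x +ℤ (-ℤ x) *ℤ + 1 ≡ + 0
    cancel = ℤ-Solver.solve-∀

  -- The exponential generating function

  sumℚᵘ : List ℚᵘ → ℚᵘ
  sumℚᵘ = List.foldr ℚᵘ._+_ ℚᵘ.0ℚᵘ

  toℚᵘ-/ : ∀ a d .{{_ : NonZero d}} → toℚᵘ (a ℚ./ d) ≃ mkℚᵘ a (pred d)
  toℚᵘ-/ a (suc d) = ℚ.toℚᵘ-fromℚᵘ (mkℚᵘ a d)

  toℚᵘ-sum : (h : ℕ → ℚ) (L : List ℕ) → toℚᵘ (List.foldr ℚ._+_ ℚ.0ℚ (map h L)) ≃ sumℚᵘ (map (toℚᵘ ∘ h) L)
  toℚᵘ-sum h []      = ℚᵘ.≃-refl
  toℚᵘ-sum h (i ∷ L) = ℚᵘ.≃-trans (ℚ.toℚᵘ-homo-+ (h i) _) (ℚᵘ.+-congʳ (toℚᵘ (h i)) (toℚᵘ-sum h L))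

  sumℚᵘ-map-cong : (f g : ℕ → ℚᵘ) (L : List ℕ) → (∀ {i} → i ∈ L → f i ≃ g i) → sumℚᵘ (map f L) ≃ sumℚᵘ (map g L)
  sumℚᵘ-map-cong f g []      h = ℚᵘ.≃-refl
  sumℚᵘ-map-cong f g (i ∷ L) h = ℚᵘ.+-cong (h (here refl)) (sumℚᵘ-map-cong f g L (h ∘ there))

  sumℚᵘ-mkℚᵘ : (c : ℕ → ℤ) (d : ℕ) (L : List ℕ) → sumℚᵘ (map (λ i → mkℚᵘ (c i) d) L) ≃ mkℚᵘ (sumℤ (map c L)) d
  sumℚᵘ-mkℚᵘ c d []      = *≡* (trans (ℤ.*-zeroˡ (+ suc d)) (sym (ℤ.*-zeroˡ (+ 1))))
  sumℚᵘ-mkℚᵘ c d (i ∷ L) = ℚᵘ.≃-trans (ℚᵘ.+-congʳ (mkℚᵘ (c i) d) (sumℚᵘ-mkℚᵘ c d L)) (*≡* (begin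
    (c i *ℤ + suc d +ℤ sumℤ (map c L) *ℤ + suc d) *ℤ + suc d  ≡⟨ factor (c i) (sumℤ (map c L)) (+ suc d) ⟩
    (c i +ℤ sumℤ (map c L)) *ℤ (+ suc d *ℤ + suc d)          ≡⟨ cong ((c i +ℤ sumℤ (map c L)) *ℤ_) (ℤ.pos-* (suc d) (suc d)) ⟨
    (c i +ℤ sumℤ (map c L)) *ℤ + (suc d * suc d)             ∎))
    where
    open ≡-Reasoning
    factor : ∀ (a s e : ℤ) → (a *ℤ e +ℤ s *ℤ e) *ℤ e ≡ (a +ℤ s) *ℤ (e *ℤ e)
    factor = ℤ-Solver.solve-∀

  sgn-∸ : ∀ n i → i ≤ n → sgn (n ∸ i) ≡ sgn n *ℤ sgn i
  sgn-∸ n i i≤n = sym (begin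
    sgn n *ℤ sgn i                        ≡⟨ cong (λ z → sgn z *ℤ sgn i) (m+[n∸m]≡n i≤n) ⟨
    sgn (i + (n ∸ i)) *ℤ sgn i            ≡⟨ cong (_*ℤ sgn i) (ℤ.^-distribˡ-+-* ℤ.-1ℤ i (n ∸ i)) ⟩
    (sgn i *ℤ sgn (n ∸ i)) *ℤ sgn i       ≡⟨ rearrange (sgn i) (sgn (n ∸ i)) ⟩
    sgn (n ∸ i) *ℤ (sgn i *ℤ sgn i)       ≡⟨ cong (sgn (n ∸ i) *ℤ_) (sgn-square i) ⟩
    sgn (n ∸ i) *ℤ + 1                    ≡⟨ ℤ.*-identityʳ _ ⟩
    sgn (n ∸ i)                           ∎)
    where
    open ≡-Reasoning
    rearrange : ∀ (a b : ℤ) → (a *ℤ b) *ℤ a ≡ b *ℤ (a *ℤ a)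
    rearrange = ℤ-Solver.solve-∀
    sgn-square : ∀ a → sgn a *ℤ sgn a ≡ + 1
    sgn-square zero    = refl
    sgn-square (suc a) = trans (square-neg (sgn a)) (sgn-square a)
      where
      square-neg : ∀ s → (ℤ.-1ℤ *ℤ s) *ℤ (ℤ.-1ℤ *ℤ s) ≡ s *ℤ s
      square-neg = ℤ-Solver.solve-∀

  -- Since n!^t = binom n i ^ t · i!^t · (n - i)!^t, both factors live over the denominator n!^t.
  coefficient-product : ∀ t n i → i ≤ n →
    toℚᵘ (Wseries t i ℚ.* fseries t (n ∸ i)) ≃ mkℚᵘ (+ w t i *ℤ sgn (n ∸ i) *ℤ + (binom n i ^ t)) (pred ((n !) ^ t))
  coefficient-product t n i i≤n = ℚᵘ.≃-trans
    (ℚᵘ.≃-trans (ℚ.toℚᵘ-homo-* (Wseries t i) (fseries t j))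
                (ℚᵘ.*-cong (toℚᵘ-/ (+ w t i) a {{a≢0}}) (toℚᵘ-/ (sgn j) b {{b≢0}})))
    (*≡* (begin
      (+ w t i *ℤ sgn j) *ℤ + suc (pred d)
        ≡⟨ cong (λ z → (+ w t i *ℤ sgn j) *ℤ + z) (trans (suc-pred d {{d≢0}}) d≡) ⟩
      (+ w t i *ℤ sgn j) *ℤ + (binom n i ^ t * (a * b))
        ≡⟨ cong ((+ w t i *ℤ sgn j) *ℤ_) (ℤ.pos-* (binom n i ^ t) (a * b)) ⟩
      (+ w t i *ℤ sgn j) *ℤ (+ (binom n i ^ t) *ℤ + (a * b))
        ≡⟨ ℤ.*-assoc (+ w t i *ℤ sgn j) (+ (binom n i ^ t)) (+ (a * b)) ⟨
      (+ w t i *ℤ sgn j *ℤ + (binom n i ^ t)) *ℤ + (a * b)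
        ≡⟨ cong (λ z → (+ w t i *ℤ sgn j *ℤ + (binom n i ^ t)) *ℤ + z)
                (cong₂ _*_ (suc-pred a {{a≢0}}) (suc-pred b {{b≢0}})) ⟨
      (+ w t i *ℤ sgn j *ℤ + (binom n i ^ t)) *ℤ + (suc (pred a) * suc (pred b)) ∎))
    where
    open ≡-Reasoning
    j = n ∸ i
    a = (i !) ^ t
    b = (j !) ^ t
    d = (n !) ^ t
    a≢0 : NonZero a
    a≢0 = m^n≢0 (i !) t {{i !≢0}}
    b≢0 : NonZero b
    b≢0 = m^n≢0 (j !) t {{j !≢0}}
    d≢0 : NonZero d
    d≢0 = m^n≢0 (n !) t {{n !≢0}}
    i+j≡n : i + j ≡ n
    i+j≡n = m+[n∸m]≡n i≤n
    d≡ : d ≡ binom n i ^ t * (a * b)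
    d≡ = begin
      (n !) ^ t                                      ≡⟨ cong (λ z → (z !) ^ t) i+j≡n ⟨
      ((i + j) !) ^ t                                ≡⟨ cong (_^ t) (binom-factorials i j) ⟨
      (binom (i + j) i * (i ! * j !)) ^ t            ≡⟨ ^-distribʳ-* (binom (i + j) i) (i ! * j !) t ⟩
      binom (i + j) i ^ t * (i ! * j !) ^ t          ≡⟨ cong (binom (i + j) i ^ t *_) (^-distribʳ-* (i !) (j !) t) ⟩
      binom (i + j) i ^ t * (a * b)                  ≡⟨ cong (λ z → binom z i ^ t * (a * b)) i+j≡n ⟩
      binom n i ^ t * (a * b)                        ∎

  Wseries-fseries-inverse : ∀ t → (∀ m → sumℤTo (suc m) (λ i → sgn i *ℤ + w t i *ℤ + ((suc m C i) ^ t)) ≡ + 0) →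
    ∀ n → (Wseries t ·ₚ fseries t) n ≡ oneₚ n
  Wseries-fseries-inverse t recurrence n = ℚ.toℚᵘ-injective (ℚᵘ.≃-trans common-denominator (numerator n recurrence))
    where
    c : ℕ → ℤ
    c i = + w t i *ℤ sgn (n ∸ i) *ℤ + (binom n i ^ t)
    common-denominator : toℚᵘ ((Wseries t ·ₚ fseries t) n) ≃ mkℚᵘ (sumℤ (map c (upTo (suc n)))) (pred ((n !) ^ t))
    common-denominator = ℚᵘ.≃-trans (toℚᵘ-sum (λ i → Wseries t i ℚ.* fseries t (n ∸ i)) (upTo (suc n)))
      (ℚᵘ.≃-trans (sumℚᵘ-map-cong _ _ (upTo (suc n)) (λ {i} i∈ → coefficient-product t n i (≤-pred (∈-upTo⁻ i∈))))
                  (sumℚᵘ-mkℚᵘ c (pred ((n !) ^ t)) (upTo (suc n))))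
    numerator : ∀ n → (∀ m → sumℤTo (suc m) (λ i → sgn i *ℤ + w t i *ℤ + ((suc m C i) ^ t)) ≡ + 0) →
      mkℚᵘ (sumℤ (map (λ i → + w t i *ℤ sgn (n ∸ i) *ℤ + (binom n i ^ t)) (upTo (suc n)))) (pred ((n !) ^ t)) ≃ toℚᵘ (oneₚ n)
    numerator zero    _          rewrite ^-zeroˡ t = *≡* refl
    numerator (suc m) recurrence = *≡* (begin
      sumℤ (map (λ i → + w t i *ℤ sgn (suc m ∸ i) *ℤ + (binom (suc m) i ^ t)) (upTo (suc (suc m)))) *ℤ + 1
        ≡⟨ ℤ.*-identityʳ _ ⟩
      sumℤ (map (λ i → + w t i *ℤ sgn (suc m ∸ i) *ℤ + (binom (suc m) i ^ t)) (upTo (suc (suc m))))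
        ≡⟨ sumℤ-map-cong _ _ (upTo (suc (suc m))) pull-sign ⟩
      sumℤ (map (λ i → sgn (suc m) *ℤ p i) (upTo (suc (suc m))))
        ≡⟨ sumℤ-map-*ˡ (sgn (suc m)) p (upTo (suc (suc m))) ⟩
      sgn (suc m) *ℤ sumℤTo (suc m) p
        ≡⟨ cong (sgn (suc m) *ℤ_) (recurrence m) ⟩
      sgn (suc m) *ℤ + 0
        ≡⟨ ℤ.*-zeroʳ (sgn (suc m)) ⟩
      + 0
        ≡⟨ ℤ.*-zeroˡ (+ suc (pred ((suc m !) ^ t))) ⟨
      + 0 *ℤ + suc (pred ((suc m !) ^ t)) ∎)
      where
      open ≡-Reasoning
      p : ℕ → ℤ
      p i = sgn i *ℤ + w t i *ℤ + ((suc m C i) ^ t)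
      pull-sign : ∀ {i} → i ∈ upTo (suc (suc m)) →
        + w t i *ℤ sgn (suc m ∸ i) *ℤ + (binom (suc m) i ^ t) ≡ sgn (suc m) *ℤ p i
      pull-sign {i} i∈ = trans
        (cong₂ (λ a b → + w t i *ℤ a *ℤ + (b ^ t)) (sgn-∸ (suc m) i (≤-pred (∈-upTo⁻ i∈))) (sym (C≡binom (suc m) i)))
        (rearrange (+ w t i) (sgn (suc m)) (sgn i) (+ ((suc m C i) ^ t)))
        where
        rearrange : ∀ (x sn si y : ℤ) → x *ℤ (sn *ℤ si) *ℤ y ≡ sn *ℤ (si *ℤ x *ℤ y)
        rearrange = ℤ-Solver.solve-∀

-- Outside the development, _*_ is multiplication on ℤ.
open import Defs
open import Data.Nat.Base using (ℕ; zero; suc; _≤_; _^_)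
open import Data.Nat.Combinatorics using (_C_)
open import Data.Fin.Subset using (Subset; ∣_∣)
open import Data.Integer.Base using (ℤ; +_; _*_)
open import Data.Product.Base using (_×_; _,_)
open import Relation.Binary.PropositionalEquality using (_≡_)
open RankSelectedSegrePowers
  using (mobiusSegre-formula; w-recurrence; Wseries-fseries-inverse; mobiusSegreRankSel-formula)

proposition2p9 : (t : ℕ) → 1 ≤ t →
    (∀ m → mobiusSegre t (suc m) ≡ sgn (suc m) * + w t (suc m))
    × (∀ m → sumℤTo (suc m) (λ i → sgn i * + w t i * + ((suc m C i) ^ t)) ≡ + 0)
    × (∀ n → (Wseries t ·ₚ fseries t) n ≡ oneₚ n)
    × (∀ m (J : Subset m) → mobiusSegreRankSel t m J ≡ sgn (suc ∣ J ∣) * + wJ t m J)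
proposition2p9 (suc t′) _ =
  mobiusSegre-formula t′ ,
  w-recurrence t′ ,
  Wseries-fseries-inverse (suc t′) (w-recurrence t′) ,
  mobiusSegreRankSel-formula t′
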